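{- Let $l\geq 3$ be an integer. For a condition $c(l_1,l_2)$ write $\sum_{c(l_1,l_2)}\zeta(l_1,l_2)$ for the sum of $\zeta(l_1,l_2)$ over all integers $l_1\geq 2$, $l_2\geq 1$ with $l_1+l_2=l$ satisfying $c(l_1,l_2)$ (an empty sum is $0$). (i) If $l\equiv 0 \pmod 3$, then $$\Big(\sum_{l_1\equiv 3\ (6)}-\sum_{l_1\equiv 4\ (6)}-\sum_{l_1\equiv 5\ (6)}\Big)\zeta(l_1,l_2)=\frac13\sum_{l_1\equiv 1\ (2)}\zeta(l_1,l_2).$$ (ii) If $l\equiv 1 \pmod 3$, then $$\Big(\sum_{l_1\equiv 3\ (6)}+\sum_{l_1\equiv 4\ (6)}-\sum_{l_1\equiv 5\ (6)}\Big)\zeta(l_1,l_2)=\frac13\sum_{l_1\equiv 0\ (2)}\zeta(l_1,l_2).$$ (iii) If $l\equiv 2 \pmod 3$, then $$\sum_{l_1\equiv 4\ (6)}\zeta(l_1,l_2)=\frac16\zeta(l)-\frac13\sum_{l_1\equiv 1\ (2)}\zeta(l_1,l_2).$$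
   Context: For integers $l_1\geq 2$, $l_2\geq 1$, the double zeta value is $\zeta(l_1,l_2)=\sum_{m_1>m_2>0} \frac{1}{m_1^{l_1} m_2^{l_2}}$, and $\zeta(l)=\sum_{m\geq1}m^{ -l}$ is the Riemann zeta value. Congruences $l_1\equiv a\ (n)$ mean $l_1\equiv a \pmod n$. -}

module Defs where

open import Data.Nat as ℕ using (ℕ; zero; suc; _≤_; _<_; _^_; _≡ᵇ_; _%_; _≤ᵇ_)
open import Data.Nat.Properties using (m*n≢0; m^n≢0)
open import Data.Integer using (+_)
open import Data.Rational using (ℚ; 0ℚ; _+_; _-_; _*_; _/_; ∣_∣; Positive)
import Data.Rational as ℚ
open import Data.Bool using (Bool; if_then_else_; _∧_)
open import Data.Product using (∃-syntax)

sumℚ : ℕ → (ℕ → ℚ) → ℚ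
sumℚ zero    f = 0ℚ
sumℚ (suc n) f = sumℚ n f + f n

term : ℕ → ℕ → ℕ → ℕ → ℚ
term a b l₁ l₂ =
  ((+ 1) / ((suc a ^ l₁) ℕ.* (suc b ^ l₂)))
    {{m*n≢0 (suc a ^ l₁) (suc b ^ l₂) {{m^n≢0 (suc a) l₁}} {{m^n≢0 (suc b) l₂}}}}

-- Truncated double zeta: Σ_{M ≥ m₁ > m₂ > 0} 1/(m₁^l₁ m₂^l₂)  (m₁ = a+1, m₂ = b+1)
ζ₂ : ℕ → ℕ → ℕ → ℚ
ζ₂ M l₁ l₂ = sumℚ M (λ a → sumℚ a (λ b → term a b l₁ l₂))

ζ₁ : ℕ → ℕ → ℚ
ζ₁ M l = sumℚ M (λ a → ((+ 1) / (suc a ^ l)) {{m^n≢0 (suc a) l}})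

-- Truncation at M of  Σ_{l₁ ≥ 2, l₂ ≥ 1, l₁ + l₂ = l, c l₁} ζ(l₁,l₂)
-- (l₁ ranges over 2 ≤ l₁ < l, l₂ = l - l₁)
condSum : (ℕ → Bool) → ℕ → ℕ → ℚ
condSum c l M = sumℚ l (λ l₁ → if (2 ≤ᵇ l₁) ∧ c l₁ then ζ₂ M l₁ (l ℕ.∸ l₁) else 0ℚ)

-- Equality of the real limits of two rational sequences (Bishop/Cauchy-real
-- equality):  ∀ ε > 0, ∃ N, ∀ M ≥ N, |f M - g M| < ε.
_≈lim_ : (ℕ → ℚ) → (ℕ → ℚ) → Set
f ≈lim g = ∀ (ε : ℚ) → Positive ε → ∃[ N ] (∀ M → N ≤ M → ∣ f M - g M ∣ ℚ.< ε)

≡mod6 : ℕ → ℕ → Bool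
≡mod6 r l₁ = l₁ % 6 ≡ᵇ r

≡mod2 : ℕ → ℕ → Bool
≡mod2 r l₁ = l₁ % 2 ≡ᵇ r

module Submission where

-- Compare two ways of multiplying single zeta values.  The stuffle product
--   ζ(a) ζ(b) = ζ(a, b) + ζ(b, a) + ζ(a + b)
-- and the shuffle product, which comes from 1/(x y) = 1/(x + y) · (1/x + 1/y): for any weights ν,
--   Σ_{a+b=N} ν(a) ζ(a+1) ζ(b+1) = Σ_{i+f=N} (Δⁱν(0) + Δⁱν(f)) ζ(i+1, f+1),   Δν(a) = ν(a) + ν(a+1).
-- Their difference is a linear relation among the double zeta values of weight N + 2.  Truncated at M,
-- the stuffle identity holds exactly for m₁, m₂ ≤ M and the shuffle identity for m₁ + m₂ ≤ M; the gap
-- between the two truncations of ζ(a) ζ(b) is O(1/M) when a, b ≥ 2 or a ≥ 3, and the two boundary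
-- terms with an exponent 1 merge into (ν(0) + ν(N)) times a single such gap.  In each congruence class
-- of the weight, ν is taken 3-periodic with a correction at 0; Δ then acts with period 6, and on one
-- period the coefficients of the relation are the indicator combinations of the theorem.

open import Defs
open import Data.Nat using (ℕ; _≤_; _%_)
open import Data.Integer using (+_)
open import Data.Rational using (_+_; _-_; _*_; _/_)
open import Data.Product using (_×_)
open import Relation.Binary.PropositionalEquality using (_≡_)

open import Algebra.Bundles using (CommutativeMonoid)
import Algebra.Properties.CommutativeSemigroup as CommSemigroupProps
open import Data.Bool using (Bool; true; false; if_then_else_; T; _∧_)
open import Data.Bool.Properties using (T-≡)
open import Data.Empty using (⊥-elim)
import Data.Integer as ℤ
open import Data.Integer using (+≤+)
import Data.Integer.Properties as ℤₚ
import Data.Integer.Tactic.RingSolver as ℤ-Ring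
open import Data.List using (List; _∷_; [])
open import Data.Nat as ℕ using (zero; suc; _∸_; _<_; z≤n; s≤s)
open import Data.Nat.DivMod using (m≡m%n+[m/n]*n; m%n<n; %-distribˡ-+; m%n%n≡m%n; m∣n⇒o%n%m≡o%m)
open import Data.Nat.Divisibility using (divides)
import Data.Nat.Properties as ℕₚ
import Data.Nat.Tactic.RingSolver as ℕ-Ring
open import Data.Product using (∃-syntax; _,_; proj₁; proj₂)
open import Data.Rational as ℚ using (ℚ; mkℚ; 0ℚ; 1ℚ; ½; 1/_; fromℚᵘ)
open import Data.Rational.Properties
open import Data.Rational.Solver using (module +-*-Solver)
import Data.Rational.Unnormalised as ℚᵘ
import Data.Rational.Unnormalised.Properties as ℚᵘₚ
open import Data.Sum using (_⊎_; inj₁; inj₂)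
open import Function.Bundles using (Equivalence)
open import Relation.Binary.PropositionalEquality
  using (refl; sym; trans; cong; cong₂; subst; subst₂; _≢_; module ≡-Reasoning)
open import Relation.Nullary using (¬_; Dec)
open import Relation.Nullary.Decidable using (True; _→-dec_; toWitness)

open +-*-Solver using (solve; _:=_; _:+_; _:-_; _:*_; con)

+-congˡ : ∀ a {x y} → x ≡ y → a + x ≡ a + y
+-congˡ a = cong (λ x → a + x)

+-interchange : ∀ a b c d → (a + b) + (c + d) ≡ (a + c) + (b + d)
+-interchange =
  CommSemigroupProps.interchange (CommutativeMonoid.commutativeSemigroup +-0-commutativeMonoid)

sub-interchange : ∀ a b c d → (a - b) + (c - d) ≡ (a + c) - (b + d)
sub-interchange = solve 4 (λ a b c d → (a :- b) :+ (c :- d) := (a :+ c) :- (b :+ d)) refl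

0≤1 : 0ℚ ℚ.≤ 1ℚ
0≤1 = nonNegative⁻¹ 1ℚ

*-nonNeg : ∀ {a b} → 0ℚ ℚ.≤ a → 0ℚ ℚ.≤ b → 0ℚ ℚ.≤ a * b
*-nonNeg {a} {b} 0≤a 0≤b = nonNegative⁻¹ (a * b)
  {{nonNeg*nonNeg⇒nonNeg a {{ℚ.nonNegative 0≤a}} b {{ℚ.nonNegative 0≤b}}}}

+-nonNeg : ∀ {a b} → 0ℚ ℚ.≤ a → 0ℚ ℚ.≤ b → 0ℚ ℚ.≤ a + b
+-nonNeg {a} {b} 0≤a 0≤b = nonNegative⁻¹ (a + b)
  {{nonNeg+nonNeg⇒nonNeg a {{ℚ.nonNegative 0≤a}} b {{ℚ.nonNegative 0≤b}}}}

*-mono-≤-nonNeg : ∀ {a b c d} → 0ℚ ℚ.≤ a → 0ℚ ℚ.≤ c → a ℚ.≤ b → c ℚ.≤ d → a * c ℚ.≤ b * d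
*-mono-≤-nonNeg {a} {b} {c} {d} 0≤a 0≤c a≤b c≤d =
  ≤-trans (*-monoʳ-≤-nonNeg c {{ℚ.nonNegative 0≤c}} a≤b)
          (*-monoˡ-≤-nonNeg b {{ℚ.nonNegative (≤-trans 0≤a a≤b)}} c≤d)

x≤x+y : ∀ x {y} → 0ℚ ℚ.≤ y → x ℚ.≤ x + y
x≤x+y x {y} 0≤y = subst (ℚ._≤ x + y) (+-identityʳ x) (+-monoʳ-≤ x 0≤y)

y≤x+y : ∀ {x} y → 0ℚ ℚ.≤ x → y ℚ.≤ x + y
y≤x+y {x} y 0≤x = subst (ℚ._≤ x + y) (+-identityˡ y) (+-monoˡ-≤ y 0≤x)

fromℚᵘ-homo-* : ∀ p q → fromℚᵘ (p ℚᵘ.* q) ≡ fromℚᵘ p * fromℚᵘ q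
fromℚᵘ-homo-* p q = toℚᵘ-injective (ℚᵘₚ.≃-trans (toℚᵘ-fromℚᵘ (p ℚᵘ.* q))
  (ℚᵘₚ.≃-sym (ℚᵘₚ.≃-trans (toℚᵘ-homo-* (fromℚᵘ p) (fromℚᵘ q))
    (ℚᵘₚ.*-cong (toℚᵘ-fromℚᵘ p) (toℚᵘ-fromℚᵘ q)))))

fromℚᵘ-homo-+ : ∀ p q → fromℚᵘ (p ℚᵘ.+ q) ≡ fromℚᵘ p + fromℚᵘ q
fromℚᵘ-homo-+ p q = toℚᵘ-injective (ℚᵘₚ.≃-trans (toℚᵘ-fromℚᵘ (p ℚᵘ.+ q))
  (ℚᵘₚ.≃-sym (ℚᵘₚ.≃-trans (toℚᵘ-homo-+ (fromℚᵘ p) (fromℚᵘ q))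
    (ℚᵘₚ.+-cong (toℚᵘ-fromℚᵘ p) (toℚᵘ-fromℚᵘ q)))))

fromℚᵘ-mono-≤ : ∀ {p q} → p ℚᵘ.≤ q → fromℚᵘ p ℚ.≤ fromℚᵘ q
fromℚᵘ-mono-≤ {p} {q} p≤q = toℚᵘ-cancel-≤
  (ℚᵘₚ.≤-respʳ-≃ (ℚᵘₚ.≃-sym (toℚᵘ-fromℚᵘ q))
    (ℚᵘₚ.≤-respˡ-≃ (ℚᵘₚ.≃-sym (toℚᵘ-fromℚᵘ p)) p≤q))

ℕ→ℚ : ℕ → ℚ
ℕ→ℚ n = + n / 1

ℕ→ℚ-suc : ∀ n → ℕ→ℚ (suc n) ≡ ℕ→ℚ n + 1ℚ
ℕ→ℚ-suc n = trans (fromℚᵘ-cong {ℚᵘ.mkℚᵘ (+ suc n) 0} {m ℚᵘ.+ ℚᵘ.1ℚᵘ} (ℚᵘ.*≡* (cross (+ n))))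
                  (fromℚᵘ-homo-+ m ℚᵘ.1ℚᵘ)
  where
  m : ℚᵘ.ℚᵘ
  m = ℚᵘ.mkℚᵘ (+ n) 0
  cross : ∀ x → (+ 1 ℤ.+ x) ℤ.* + 1 ≡ (x ℤ.* + 1 ℤ.+ + 1 ℤ.* + 1) ℤ.* + 1
  cross = ℤ-Ring.solve-∀

ℕ→ℚ-mono-≤ : ∀ {m n} → m ≤ n → ℕ→ℚ m ℚ.≤ ℕ→ℚ n
ℕ→ℚ-mono-≤ {m} {n} m≤n = fromℚᵘ-mono-≤ {ℚᵘ.mkℚᵘ (+ m) 0} {ℚᵘ.mkℚᵘ (+ n) 0}
  (ℚᵘ.*≤* (subst₂ ℤ._≤_ (sym (ℤₚ.*-identityʳ (+ m))) (sym (ℤₚ.*-identityʳ (+ n))) (+≤+ m≤n)))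

ℕ→ℚ-nonNeg : ∀ n → 0ℚ ℚ.≤ ℕ→ℚ n
ℕ→ℚ-nonNeg n = ℕ→ℚ-mono-≤ {0} {n} z≤n

infixr 8 _^_
_^_ : ℚ → ℕ → ℚ
x ^ zero = 1ℚ
x ^ suc k = x * x ^ k

^-+ : ∀ x m n → x ^ (m ℕ.+ n) ≡ x ^ m * x ^ n
^-+ x zero    n = sym (*-identityˡ _)
^-+ x (suc m) n = trans (cong (x *_) (^-+ x m n)) (sym (*-assoc x _ _))

^-nonNeg : ∀ {x} k → 0ℚ ℚ.≤ x → 0ℚ ℚ.≤ x ^ k
^-nonNeg zero    0≤x = 0≤1
^-nonNeg (suc k) 0≤x = *-nonNeg 0≤x (^-nonNeg k 0≤x)

^-mono-≤ : ∀ {x y} k → 0ℚ ℚ.≤ x → x ℚ.≤ y → x ^ k ℚ.≤ y ^ k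
^-mono-≤ zero    0≤x x≤y = ≤-refl
^-mono-≤ (suc k) 0≤x x≤y = *-mono-≤-nonNeg 0≤x (^-nonNeg k 0≤x) x≤y (^-mono-≤ k 0≤x x≤y)

^≤1 : ∀ {x} k → 0ℚ ℚ.≤ x → x ℚ.≤ 1ℚ → x ^ k ℚ.≤ 1ℚ
^≤1 {x} k 0≤x x≤1 = subst (x ^ k ℚ.≤_) (1^k k) (^-mono-≤ k 0≤x x≤1)
  where
  1^k : ∀ k → 1ℚ ^ k ≡ 1ℚ
  1^k zero    = refl
  1^k (suc k) = trans (*-identityˡ _) (1^k k)

^-antimono-+ : ∀ {x} k d → 0ℚ ℚ.≤ x → x ℚ.≤ 1ℚ → x ^ (k ℕ.+ d) ℚ.≤ x ^ k
^-antimono-+ {x} k d 0≤x x≤1 = begin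
  x ^ (k ℕ.+ d)  ≡⟨ ^-+ x k d ⟩
  x ^ k * x ^ d  ≤⟨ *-monoˡ-≤-nonNeg (x ^ k) {{ℚ.nonNegative (^-nonNeg k 0≤x)}} (^≤1 d 0≤x x≤1) ⟩
  x ^ k * 1ℚ     ≡⟨ *-identityʳ (x ^ k) ⟩
  x ^ k          ∎
  where open ≤-Reasoning

recip : ℕ → ℚ
recip n = + 1 / suc n

1/[m*n]≡1/m*1/n : ∀ m n .{{_ : ℕ.NonZero m}} .{{_ : ℕ.NonZero n}} →
                  (+ 1 / (m ℕ.* n)) {{ℕₚ.m*n≢0 m n}} ≡ (+ 1 / m) * (+ 1 / n)
1/[m*n]≡1/m*1/n (suc m) (suc n) = fromℚᵘ-homo-* (ℚᵘ.mkℚᵘ (+ 1) m) (ℚᵘ.mkℚᵘ (+ 1) n)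

1/[1+a]^k≡recip^k : ∀ a k → (+ 1 / (suc a ℕ.^ k)) {{ℕₚ.m^n≢0 (suc a) k}} ≡ recip a ^ k
1/[1+a]^k≡recip^k a zero    = refl
1/[1+a]^k≡recip^k a (suc k) =
  trans (1/[m*n]≡1/m*1/n (suc a) (suc a ℕ.^ k) {{_}} {{ℕₚ.m^n≢0 (suc a) k}})
        (cong (recip a *_) (1/[1+a]^k≡recip^k a k))

term≡recip^ : ∀ a b l₁ l₂ → term a b l₁ l₂ ≡ recip a ^ l₁ * recip b ^ l₂
term≡recip^ a b l₁ l₂ =
  trans (1/[m*n]≡1/m*1/n (suc a ℕ.^ l₁) (suc b ℕ.^ l₂) {{ℕₚ.m^n≢0 (suc a) l₁}} {{ℕₚ.m^n≢0 (suc b) l₂}})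
        (cong₂ _*_ (1/[1+a]^k≡recip^k a l₁) (1/[1+a]^k≡recip^k b l₂))

recip-partialFraction : ∀ e d → recip (suc (e ℕ.+ d)) * (recip e + recip d) ≡ recip e * recip d
recip-partialFraction e d = begin
  fromℚᵘ c * (fromℚᵘ u + fromℚᵘ v) ≡⟨ cong (fromℚᵘ c *_) (fromℚᵘ-homo-+ u v) ⟨
  fromℚᵘ c * fromℚᵘ (u ℚᵘ.+ v)      ≡⟨ fromℚᵘ-homo-* c (u ℚᵘ.+ v) ⟨
  fromℚᵘ (c ℚᵘ.* (u ℚᵘ.+ v))        ≡⟨ fromℚᵘ-cong {c ℚᵘ.* (u ℚᵘ.+ v)} {u ℚᵘ.* v}
                                         (ℚᵘ.*≡* (cong +_ (cross e d))) ⟩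
  fromℚᵘ (u ℚᵘ.* v)                 ≡⟨ fromℚᵘ-homo-* u v ⟩
  fromℚᵘ u * fromℚᵘ v               ∎
  where
  open ≡-Reasoning
  c u v : ℚᵘ.ℚᵘ
  c = ℚᵘ.mkℚᵘ (+ 1) (suc (e ℕ.+ d))
  u = ℚᵘ.mkℚᵘ (+ 1) e
  v = ℚᵘ.mkℚᵘ (+ 1) d
  cross : ∀ e d → (1 ℕ.* (1 ℕ.* suc d ℕ.+ 1 ℕ.* suc e)) ℕ.* (suc e ℕ.* suc d)
                ≡ (1 ℕ.* 1) ℕ.* (suc (suc (e ℕ.+ d)) ℕ.* (suc e ℕ.* suc d))
  cross = ℕ-Ring.solve-∀

recip-suc : ∀ M → recip (suc M) * (recip M + 1ℚ) ≡ recip M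
recip-suc M = begin
  recip (suc M) * (recip M + 1ℚ)
    ≡⟨ cong (λ k → recip (suc k) * (recip M + 1ℚ)) (ℕₚ.+-identityʳ M) ⟨
  recip (suc (M ℕ.+ 0)) * (recip M + recip 0)
    ≡⟨ recip-partialFraction M 0 ⟩
  recip M * 1ℚ
    ≡⟨ *-identityʳ (recip M) ⟩
  recip M ∎
  where open ≡-Reasoning

recip-nonNeg : ∀ n → 0ℚ ℚ.≤ recip n
recip-nonNeg n = fromℚᵘ-mono-≤ {ℚᵘ.0ℚᵘ} {ℚᵘ.mkℚᵘ (+ 1) n} (ℚᵘ.*≤* (+≤+ z≤n))

recip≤1 : ∀ n → recip n ℚ.≤ 1ℚ
recip≤1 n = fromℚᵘ-mono-≤ {ℚᵘ.mkℚᵘ (+ 1) n} {ℚᵘ.1ℚᵘ} (ℚᵘ.*≤* (+≤+ (s≤s z≤n)))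

recip-≤-double : ∀ i M → M ≤ suc (i ℕ.+ i) → recip i ℚ.≤ recip M + recip M
recip-≤-double i M M≤2i+1 = subst (recip i ℚ.≤_) (fromℚᵘ-homo-+ m m)
  (fromℚᵘ-mono-≤ {ℚᵘ.mkℚᵘ (+ 1) i} {m ℚᵘ.+ m} (ℚᵘ.*≤* (+≤+ cross)))
  where
  open ℕₚ.≤-Reasoning
  m : ℚᵘ.ℚᵘ
  m = ℚᵘ.mkℚᵘ (+ 1) M
  M+1≤2[i+1] : suc M ≤ suc i ℕ.+ suc i
  M+1≤2[i+1] = ℕₚ.≤-trans (s≤s M≤2i+1) (ℕₚ.≤-reflexive (cong suc (sym (ℕₚ.+-suc i i))))
  cross : 1 ℕ.* (suc M ℕ.* suc M) ≤ (1 ℕ.* suc M ℕ.+ 1 ℕ.* suc M) ℕ.* suc i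
  cross = begin
    1 ℕ.* (suc M ℕ.* suc M)           ≡⟨ ℕ-Ring.solve (M ∷ []) ⟩
    suc M ℕ.* suc M                   ≤⟨ ℕₚ.*-monoʳ-≤ (suc M) M+1≤2[i+1] ⟩
    suc M ℕ.* (suc i ℕ.+ suc i)       ≡⟨ ℕ-Ring.solve (M ∷ i ∷ []) ⟩
    (1 ℕ.* suc M ℕ.+ 1 ℕ.* suc M) ℕ.* suc i ∎

recip*ℕ→ℚ-suc : ∀ n → recip n * ℕ→ℚ (suc n) ≡ 1ℚ
recip*ℕ→ℚ-suc n = trans (sym (fromℚᵘ-homo-* r m))
  (fromℚᵘ-cong {r ℚᵘ.* m} {ℚᵘ.1ℚᵘ} (ℚᵘ.*≡* (cong +_ (ℕ-Ring.solve (n ∷ [])))))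
  where
  r m : ℚᵘ.ℚᵘ
  r = ℚᵘ.mkℚᵘ (+ 1) n
  m = ℚᵘ.mkℚᵘ (+ suc n) 0

recip*ℕ→ℚ≤1 : ∀ n → recip n * ℕ→ℚ n ℚ.≤ 1ℚ
recip*ℕ→ℚ≤1 n = begin
  recip n * ℕ→ℚ n        ≤⟨ *-monoˡ-≤-nonNeg (recip n) {{ℚ.nonNegative (recip-nonNeg n)}}
                                                (ℕ→ℚ-mono-≤ (ℕₚ.n≤1+n n)) ⟩
  recip n * ℕ→ℚ (suc n)  ≡⟨ recip*ℕ→ℚ-suc n ⟩
  1ℚ                     ∎
  where open ≤-Reasoning

ℕ→ℚ*recip≡ : ∀ C M → ℕ→ℚ C * recip M ≡ fromℚᵘ (ℚᵘ.mkℚᵘ (+ C) M)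
ℕ→ℚ*recip≡ C M = trans (sym (fromℚᵘ-homo-* c r))
  (fromℚᵘ-cong {c ℚᵘ.* r} {ℚᵘ.mkℚᵘ (+ C) M} (ℚᵘ.*≡* (cross (+ C) (+ suc M))))
  where
  c r : ℚᵘ.ℚᵘ
  c = ℚᵘ.mkℚᵘ (+ C) 0
  r = ℚᵘ.mkℚᵘ (+ 1) M
  cross : ∀ x y → (x ℤ.* + 1) ℤ.* y ≡ x ℤ.* (+ 1 ℤ.* y)
  cross = ℤ-Ring.solve-∀

recip²-telescoping : ∀ M → recip M ^ 2 + (recip (suc M) + recip (suc M)) ℚ.≤ recip M + recip M
recip²-telescoping M = begin
  a ^ 2 + (b + b)           ≡⟨ cong (λ x → x + (b + b)) (cong (a *_) (*-identityʳ a)) ⟩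
  a * a + (b + b)           ≤⟨ +-monoˡ-≤ (b + b) (*-monoˡ-≤-nonNeg a {{ℚ.nonNegative (recip-nonNeg M)}} a≤2b) ⟩
  a * (b + b) + (b + b)     ≡⟨ solve 2 (λ a b → a :* (b :+ b) :+ (b :+ b) := b :* (a :+ con 1ℚ) :+ b :* (a :+ con 1ℚ))
                                       refl a b ⟩
  b * (a + 1ℚ) + b * (a + 1ℚ) ≡⟨ cong₂ _+_ (recip-suc M) (recip-suc M) ⟩
  a + a                     ∎
  where
  open ≤-Reasoning
  a b : ℚ
  a = recip M
  b = recip (suc M)
  a≤2b : a ℚ.≤ b + b
  a≤2b = recip-≤-double M (suc M) (s≤s (ℕₚ.m≤m+n M M))

sum-recip²≤2 : ∀ M → sumℚ M (λ j → recip j ^ 2) ℚ.≤ 1ℚ + 1ℚ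
sum-recip²≤2 M = ≤-trans (x≤x+y _ (+-nonNeg (recip-nonNeg M) (recip-nonNeg M))) (invariant M)
  where
  invariant : ∀ M → sumℚ M (λ j → recip j ^ 2) + (recip M + recip M) ℚ.≤ 1ℚ + 1ℚ
  invariant zero    = ≤-refl
  invariant (suc M) = begin
    (S + recip M ^ 2) + (recip (suc M) + recip (suc M)) ≡⟨ +-assoc S _ _ ⟩
    S + (recip M ^ 2 + (recip (suc M) + recip (suc M))) ≤⟨ +-monoʳ-≤ S (recip²-telescoping M) ⟩
    S + (recip M + recip M)                              ≤⟨ invariant M ⟩
    1ℚ + 1ℚ                                              ∎
    where
    open ≤-Reasoning
    S : ℚ
    S = sumℚ M (λ j → recip j ^ 2)

recip^-nonNeg : ∀ i k → 0ℚ ℚ.≤ recip i ^ k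
recip^-nonNeg i k = ^-nonNeg k (recip-nonNeg i)

sum-cong : ∀ n {f g : ℕ → ℚ} → (∀ i → i < n → f i ≡ g i) → sumℚ n f ≡ sumℚ n g
sum-cong zero    eq = refl
sum-cong (suc n) eq = cong₂ _+_ (sum-cong n (λ i i<n → eq i (ℕₚ.m<n⇒m<1+n i<n))) (eq n ℕₚ.≤-refl)

sum-zero : ∀ n → sumℚ n (λ _ → 0ℚ) ≡ 0ℚ
sum-zero zero    = refl
sum-zero (suc n) = cong (_+ 0ℚ) (sum-zero n)

sum-+ : ∀ n f g → sumℚ n (λ i → f i + g i) ≡ sumℚ n f + sumℚ n g
sum-+ zero    f g = refl
sum-+ (suc n) f g = trans (cong (_+ (f n + g n)) (sum-+ n f g))
                          (+-interchange (sumℚ n f) (sumℚ n g) (f n) (g n))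

sum-- : ∀ n f g → sumℚ n (λ i → f i - g i) ≡ sumℚ n f - sumℚ n g
sum-- zero    f g = refl
sum-- (suc n) f g = trans (cong (_+ (f n - g n)) (sum-- n f g))
                          (sub-interchange (sumℚ n f) (sumℚ n g) (f n) (g n))

sum-*ˡ : ∀ n c f → sumℚ n (λ i → c * f i) ≡ c * sumℚ n f
sum-*ˡ zero    c f = sym (*-zeroʳ c)
sum-*ˡ (suc n) c f = trans (cong (_+ c * f n) (sum-*ˡ n c f)) (sym (*-distribˡ-+ c _ _))

sum-*ʳ : ∀ n f c → sumℚ n f * c ≡ sumℚ n (λ i → f i * c)
sum-*ʳ n f c = trans (*-comm _ c) (trans (sym (sum-*ˡ n c f)) (sum-cong n (λ i _ → *-comm c (f i))))

sum-unshift : ∀ n f → sumℚ (suc n) f ≡ f 0 + sumℚ n (λ i → f (suc i))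
sum-unshift zero    f = trans (+-identityˡ (f 0)) (sym (+-identityʳ (f 0)))
sum-unshift (suc n) f = trans (cong (_+ f (suc n)) (sum-unshift n f)) (+-assoc (f 0) _ _)

sum-const : ∀ n c → sumℚ n (λ _ → c) ≡ ℕ→ℚ n * c
sum-const zero    c = sym (*-zeroˡ c)
sum-const (suc n) c = begin
  sumℚ n (λ _ → c) + c    ≡⟨ cong (_+ c) (sum-const n c) ⟩
  ℕ→ℚ n * c + c           ≡⟨ solve 2 (λ m c → m :* c :+ c := (m :+ con 1ℚ) :* c) refl (ℕ→ℚ n) c ⟩
  (ℕ→ℚ n + 1ℚ) * c        ≡⟨ cong (_* c) (ℕ→ℚ-suc n) ⟨
  ℕ→ℚ (suc n) * c         ∎
  where open ≡-Reasoning

sum-mono-≤ : ∀ n {f g} → (∀ i → i < n → f i ℚ.≤ g i) → sumℚ n f ℚ.≤ sumℚ n g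
sum-mono-≤ zero    f≤g = ≤-refl
sum-mono-≤ (suc n) f≤g =
  +-mono-≤ (sum-mono-≤ n (λ i i<n → f≤g i (ℕₚ.m<n⇒m<1+n i<n))) (f≤g n ℕₚ.≤-refl)

sum-nonNeg : ∀ n {f} → (∀ i → i < n → 0ℚ ℚ.≤ f i) → 0ℚ ℚ.≤ sumℚ n f
sum-nonNeg n {f} 0≤f = subst (ℚ._≤ sumℚ n f) (sum-zero n) (sum-mono-≤ n 0≤f)

≢⇒≡ᵇ-false : ∀ {m n} → m ≢ n → (m ℕ.≡ᵇ n) ≡ false
≢⇒≡ᵇ-false {m} {n} m≢n with m ℕ.≡ᵇ n in eq
... | true  = ⊥-elim (m≢n (ℕₚ.≡ᵇ⇒≡ m n (subst T (sym eq) _)))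
... | false = refl

sum-indicator : ∀ K k (h : ℕ → ℚ) → k < K → sumℚ K (λ j → if j ℕ.≡ᵇ k then h j else 0ℚ) ≡ h k
sum-indicator (suc K) k h k<1+K with ℕₚ.m≤n⇒m<n∨m≡n (ℕₚ.≤-pred k<1+K)
... | inj₁ k<K = begin
  sumℚ K (λ j → if j ℕ.≡ᵇ k then h j else 0ℚ) + (if K ℕ.≡ᵇ k then h K else 0ℚ)
    ≡⟨ cong₂ _+_ (sum-indicator K k h k<K)
                 (cong (λ t → if t then h K else 0ℚ) (≢⇒≡ᵇ-false (ℕₚ.>⇒≢ k<K))) ⟩
  h k + 0ℚ ≡⟨ +-identityʳ (h k) ⟩
  h k      ∎
  where open ≡-Reasoning
... | inj₂ refl = begin
  sumℚ K (λ j → if j ℕ.≡ᵇ K then h j else 0ℚ) + (if K ℕ.≡ᵇ K then h K else 0ℚ)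
    ≡⟨ cong₂ _+_ (trans (sum-cong K (λ j j<K → cong (λ t → if t then h j else 0ℚ)
                                                   (≢⇒≡ᵇ-false (ℕₚ.<⇒≢ j<K))))
                        (sum-zero K))
                 (cong (λ t → if t then h K else 0ℚ) (Equivalence.to T-≡ (ℕₚ.≡⇒≡ᵇ K K refl))) ⟩
  0ℚ + h K ≡⟨ +-identityˡ (h K) ⟩
  h K      ∎
  where open ≡-Reasoning

antidiag : ℕ → (ℕ → ℕ → ℚ) → ℚ
antidiag zero    F = F 0 0
antidiag (suc n) F = F 0 (suc n) + antidiag n (λ a b → F (suc a) b)

antidiag-cong : ∀ n {F G} → (∀ a b → a ℕ.+ b ≡ n → F a b ≡ G a b) → antidiag n F ≡ antidiag n G
antidiag-cong zero    eq = eq 0 0 refl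
antidiag-cong (suc n) eq = cong₂ _+_ (eq 0 (suc n) refl) (antidiag-cong n (λ a b a+b≡n → eq (suc a) b (cong suc a+b≡n)))

antidiag-+ : ∀ n F G → antidiag n (λ a b → F a b + G a b) ≡ antidiag n F + antidiag n G
antidiag-+ zero    F G = refl
antidiag-+ (suc n) F G = trans (+-congˡ (F 0 (suc n) + G 0 (suc n)) (antidiag-+ n F′ G′))
                               (+-interchange (F 0 (suc n)) (G 0 (suc n)) (antidiag n F′) (antidiag n G′))
  where
  F′ G′ : ℕ → ℕ → ℚ
  F′ a = F (suc a)
  G′ a = G (suc a)

antidiag-- : ∀ n F G → antidiag n (λ a b → F a b - G a b) ≡ antidiag n F - antidiag n G
antidiag-- zero    F G = refl
antidiag-- (suc n) F G = trans (+-congˡ (F 0 (suc n) - G 0 (suc n)) (antidiag-- n F′ G′))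
                               (sub-interchange (F 0 (suc n)) (G 0 (suc n)) (antidiag n F′) (antidiag n G′))
  where
  F′ G′ : ℕ → ℕ → ℚ
  F′ a = F (suc a)
  G′ a = G (suc a)

antidiag-*ˡ : ∀ n c F → antidiag n (λ a b → c * F a b) ≡ c * antidiag n F
antidiag-*ˡ zero    c F = refl
antidiag-*ˡ (suc n) c F = trans (+-congˡ (c * F 0 (suc n)) (antidiag-*ˡ n c (λ a → F (suc a))))
                                (sym (*-distribˡ-+ c (F 0 (suc n)) (antidiag n (λ a → F (suc a)))))

antidiag-zero : ∀ n {F} → (∀ a b → F a b ≡ 0ℚ) → antidiag n F ≡ 0ℚ
antidiag-zero zero    eq = eq 0 0
antidiag-zero (suc n) eq = trans (cong₂ _+_ (eq 0 (suc n)) (antidiag-zero n (λ a → eq (suc a)))) (+-identityˡ 0ℚ)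

antidiag-snoc : ∀ n F → antidiag (suc n) F ≡ antidiag n (λ a b → F a (suc b)) + F (suc n) 0
antidiag-snoc zero    F = refl
antidiag-snoc (suc n) F = trans (+-congˡ (F 0 (suc (suc n))) (antidiag-snoc n (λ a → F (suc a))))
  (sym (+-assoc (F 0 (suc (suc n))) (antidiag n (λ a b → F (suc a) (suc b))) (F (suc (suc n)) 0)))

antidiag-swap : ∀ n F → antidiag n F ≡ antidiag n (λ a b → F b a)
antidiag-swap zero    F = refl
antidiag-swap (suc n) F = begin
  F 0 (suc n) + antidiag n (λ a b → F (suc a) b)   ≡⟨ +-congˡ (F 0 (suc n)) (antidiag-swap n (λ a → F (suc a))) ⟩
  F 0 (suc n) + antidiag n (λ a b → F (suc b) a)   ≡⟨ +-comm (F 0 (suc n)) _ ⟩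
  antidiag n (λ a b → F (suc b) a) + F 0 (suc n)   ≡⟨ antidiag-snoc n (λ a b → F b a) ⟨
  antidiag (suc n) (λ a b → F b a)                 ∎
  where open ≡-Reasoning

antidiag≡sum : ∀ n F → antidiag n F ≡ sumℚ (suc n) (λ a → F a (n ∸ a))
antidiag≡sum zero    F = sym (+-identityˡ _)
antidiag≡sum (suc n) F = trans (+-congˡ (F 0 (suc n)) (antidiag≡sum n (λ a → F (suc a))))
                               (sym (sum-unshift (suc n) (λ a → F a (suc n ∸ a))))

sum-antidiag : ∀ M n (F : ℕ → ℕ → ℕ → ℚ) →
               sumℚ M (λ c → antidiag n (λ a b → F a b c)) ≡ antidiag n (λ a b → sumℚ M (F a b))
sum-antidiag zero    n F = sym (antidiag-zero n (λ _ _ → refl))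
sum-antidiag (suc M) n F = trans (cong (_+ antidiag n (λ a b → F a b M)) (sum-antidiag M n F))
                                 (sym (antidiag-+ n (λ a b → sumℚ M (F a b)) (λ a b → F a b M)))

antidiag-antidiag : ∀ m n (F : ℕ → ℕ → ℕ → ℕ → ℚ) →
  antidiag m (λ a b → antidiag n (F a b)) ≡ antidiag n (λ c d → antidiag m (λ a b → F a b c d))
antidiag-antidiag zero    n F = refl
antidiag-antidiag (suc m) n F =
  trans (+-congˡ (antidiag n (F 0 (suc m))) (antidiag-antidiag m n (λ a → F (suc a))))
        (sym (antidiag-+ n (F 0 (suc m)) (λ c d → antidiag m (λ a b → F (suc a) b c d))))

box : ℕ → (ℕ → ℕ → ℚ) → ℚ
box M h = sumℚ M (λ i → sumℚ M (h i))

box-+ : ∀ M h k → box M (λ i j → h i j + k i j) ≡ box M h + box M k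
box-+ M h k = trans (sum-cong M (λ i _ → sum-+ M (h i) (k i))) (sum-+ M _ _)

box-- : ∀ M h k → box M (λ i j → h i j - k i j) ≡ box M h - box M k
box-- M h k = trans (sum-cong M (λ i _ → sum-- M (h i) (k i))) (sum-- M _ _)

box-mono-≤ : ∀ M {h k} → (∀ i j → h i j ℚ.≤ k i j) → box M h ℚ.≤ box M k
box-mono-≤ M h≤k = sum-mono-≤ M (λ i _ → sum-mono-≤ M (λ j _ → h≤k i j))

box-nonNeg : ∀ M {h} → (∀ i j → 0ℚ ℚ.≤ h i j) → 0ℚ ℚ.≤ box M h
box-nonNeg M 0≤h = sum-nonNeg M (λ i _ → sum-nonNeg M (λ j _ → 0≤h i j))

-- The stuffle product

Z₁ : ℕ → ℕ → ℚ
Z₁ M a = sumℚ M (λ m → recip m ^ a)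

Z₂ : ℕ → ℕ → ℕ → ℚ
Z₂ M j k = sumℚ M (λ c → sumℚ c (λ d → recip c ^ j * recip d ^ k))

ζ₁≡Z₁ : ∀ M a → ζ₁ M a ≡ Z₁ M a
ζ₁≡Z₁ M a = sum-cong M (λ m _ → 1/[1+a]^k≡recip^k m a)

ζ₂≡Z₂ : ∀ M j k → ζ₂ M j k ≡ Z₂ M j k
ζ₂≡Z₂ M j k = sum-cong M (λ c _ → sum-cong c (λ d _ → term≡recip^ c d j k))

Z₁-stuffle : ∀ M a b → Z₁ M a * Z₁ M b ≡ Z₂ M a b + Z₂ M b a + Z₁ M (a ℕ.+ b)
Z₁-stuffle zero    a b = refl
Z₁-stuffle (suc M) a b = begin
  (A + p) * (B + q)
    ≡⟨ expand A p B q ⟩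
  A * B + (p * B + q * A) + p * q
    ≡⟨ cong₂ (λ x y → x + (p * B + q * A) + y) (Z₁-stuffle M a b) (sym (^-+ (recip M) a b)) ⟩
  S + (p * B + q * A) + recip M ^ (a ℕ.+ b)
    ≡⟨ cong (λ x → S + x + recip M ^ (a ℕ.+ b))
            (cong₂ _+_ (sym (sum-*ˡ M p (λ d → recip d ^ b))) (sym (sum-*ˡ M q (λ d → recip d ^ a)))) ⟩
  S + (rowᵃᵇ + rowᵇᵃ) + recip M ^ (a ℕ.+ b)
    ≡⟨ regroup (Z₂ M a b) (Z₂ M b a) (Z₁ M (a ℕ.+ b)) rowᵃᵇ rowᵇᵃ (recip M ^ (a ℕ.+ b)) ⟩
  Z₂ (suc M) a b + Z₂ (suc M) b a + Z₁ (suc M) (a ℕ.+ b) ∎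
  where
  open ≡-Reasoning
  A B p q S rowᵃᵇ rowᵇᵃ : ℚ
  A = Z₁ M a
  B = Z₁ M b
  p = recip M ^ a
  q = recip M ^ b
  S = Z₂ M a b + Z₂ M b a + Z₁ M (a ℕ.+ b)
  rowᵃᵇ = sumℚ M (λ d → p * recip d ^ b)
  rowᵇᵃ = sumℚ M (λ d → q * recip d ^ a)
  expand : ∀ A p B q → (A + p) * (B + q) ≡ A * B + (p * B + q * A) + p * q
  expand = solve 4 (λ A p B q → (A :+ p) :* (B :+ q) := A :* B :+ (p :* B :+ q :* A) :+ p :* q) refl
  regroup : ∀ x y z u v w → (x + y + z) + (u + v) + w ≡ (x + u) + (y + v) + (z + w)
  regroup = solve 6 (λ x y z u v w → (x :+ y :+ z) :+ (u :+ v) :+ w := (x :+ u) :+ (y :+ v) :+ (z :+ w))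
                    refl

Z₁*Z₁≡box : ∀ M a b → Z₁ M a * Z₁ M b ≡ box M (λ i j → recip i ^ a * recip j ^ b)
Z₁*Z₁≡box M a b = trans (sum-*ʳ M (λ i → recip i ^ a) (Z₁ M b))
                        (sum-cong M (λ i _ → sym (sum-*ˡ M (recip i ^ a) (λ j → recip j ^ b))))

-- The shuffle product

Δ : (ℕ → ℚ) → ℕ → ℚ
Δ ν a = ν a + ν (suc a)

Δ^ : ℕ → (ℕ → ℚ) → ℕ → ℚ
Δ^ zero    ν = ν
Δ^ (suc i) ν = Δ^ i (Δ ν)

-- For u = 1/x, v = 1/y, s = 1/(x+y) this is the partial fraction expansion of 1/(x^(a+1) y^(b+1))
-- that underlies the shuffle product of ζ(a+1) and ζ(b+1).
module _ (u v s : ℚ) (s[u+v]≡uv : s * (u + v) ≡ u * v) where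

  private
    split : ∀ c U V → c * ((u * U) * (v * V)) ≡ s * (c * ((u * U) * V)) + s * (c * (U * (v * V)))
    split c U V = begin
      c * ((u * U) * (v * V))
        ≡⟨ solve 5 (λ c U V u v → c :* ((u :* U) :* (v :* V)) := (c :* U :* V) :* (u :* v)) refl c U V u v ⟩
      (c * U * V) * (u * v)
        ≡⟨ cong ((c * U * V) *_) s[u+v]≡uv ⟨
      (c * U * V) * (s * (u + v))
        ≡⟨ solve 6 (λ c U V u v s → (c :* U :* V) :* (s :* (u :+ v))
                                      := s :* (c :* ((u :* U) :* V)) :+ s :* (c :* (U :* (v :* V))))
                   refl c U V u v s ⟩
      s * (c * ((u * U) * V)) + s * (c * (U * (v * V))) ∎
      where open ≡-Reasoning

  geometric-shuffle : ∀ n ν →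
    antidiag n (λ a b → ν a * (u ^ suc a * v ^ suc b))
      ≡ antidiag n (λ i e → s ^ suc i * (Δ^ i ν 0 * v ^ suc e + Δ^ i ν e * u ^ suc e))
  geometric-shuffle zero ν = begin
    ν 0 * ((u * 1ℚ) * (v * 1ℚ))                               ≡⟨ split (ν 0) 1ℚ 1ℚ ⟩
    s * (ν 0 * ((u * 1ℚ) * 1ℚ)) + s * (ν 0 * (1ℚ * (v * 1ℚ))) ≡⟨ solve 4 (λ s n u v →
        s :* (n :* ((u :* con 1ℚ) :* con 1ℚ)) :+ s :* (n :* (con 1ℚ :* (v :* con 1ℚ)))
          := (s :* con 1ℚ) :* (n :* (v :* con 1ℚ) :+ n :* (u :* con 1ℚ))) refl s (ν 0) u v ⟩
    (s * 1ℚ) * (ν 0 * (v * 1ℚ) + ν 0 * (u * 1ℚ))             ∎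
    where open ≡-Reasoning
  geometric-shuffle (suc n) ν = begin
    antidiag (suc n) (λ a b → ν a * (u ^ suc a * v ^ suc b))
      ≡⟨ antidiag-cong (suc n) (λ a b _ → split (ν a) (u ^ a) (v ^ b)) ⟩
    antidiag (suc n) (λ a b → s * X a b + s * Y a b)
      ≡⟨ antidiag-+ (suc n) (λ a b → s * X a b) (λ a b → s * Y a b) ⟩
    antidiag (suc n) (λ a b → s * X a b) + antidiag (suc n) (λ a b → s * Y a b)
      ≡⟨ cong₂ _+_ (antidiag-*ˡ (suc n) s X) (antidiag-*ˡ (suc n) s Y) ⟩
    s * antidiag (suc n) X + s * antidiag (suc n) Y
      ≡⟨ cong (λ x → s * x + s * antidiag (suc n) Y) (antidiag-snoc n X) ⟩
    s * (antidiag n X′ + X (suc n) 0) + s * (Y 0 (suc n) + antidiag n Y′)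
      ≡⟨ solve 5 (λ s p q r t → s :* (p :+ q) :+ s :* (r :+ t) := s :* (r :+ q) :+ s :* (p :+ t)) refl
           s (antidiag n X′) (X (suc n) 0) (Y 0 (suc n)) (antidiag n Y′) ⟩
    s * (Y 0 (suc n) + X (suc n) 0) + s * (antidiag n X′ + antidiag n Y′)
      ≡⟨ cong₂ (λ p q → s * p + s * q) (sym ends) (antidiag-+ n X′ Y′) ⟨
    s * end + s * antidiag n (λ a b → X′ a b + Y′ a b)
      ≡⟨ +-congˡ (s * end) (cong (s *_) (antidiag-cong n (λ a b _ → middle a b))) ⟩
    s * end + s * antidiag n (λ a b → Δ ν a * (u ^ suc a * v ^ suc b))
      ≡⟨ +-congˡ (s * end) (cong (s *_) (geometric-shuffle n (Δ ν))) ⟩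
    s * end + s * antidiag n (λ i e → s ^ suc i * (Δ^ i (Δ ν) 0 * v ^ suc e + Δ^ i (Δ ν) e * u ^ suc e))
      ≡⟨ cong₂ _+_ (cong (_* end) (*-identityʳ s)) (antidiag-*ˡ n s _) ⟨
    (s * 1ℚ) * end + antidiag n (λ i e → s * (s ^ suc i * (Δ^ i (Δ ν) 0 * v ^ suc e + Δ^ i (Δ ν) e * u ^ suc e)))
      ≡⟨ +-congˡ ((s * 1ℚ) * end) (antidiag-cong n (λ i e _ → sym (*-assoc s _ _))) ⟩
    antidiag (suc n) (λ i e → s ^ suc i * (Δ^ i ν 0 * v ^ suc e + Δ^ i ν e * u ^ suc e)) ∎
    where
    open ≡-Reasoning
    X Y X′ Y′ : ℕ → ℕ → ℚ
    X a b = ν a * ((u * u ^ a) * v ^ b)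
    Y a b = ν a * (u ^ a * (v * v ^ b))
    X′ a b = X a (suc b)
    Y′ a b = Y (suc a) b
    end : ℚ
    end = ν 0 * v ^ suc (suc n) + ν (suc n) * u ^ suc (suc n)
    ends : Y 0 (suc n) + X (suc n) 0 ≡ end
    ends = solve 4 (λ n₀ n₁ V U → n₀ :* (con 1ℚ :* V) :+ n₁ :* (U :* con 1ℚ) := n₀ :* V :+ n₁ :* U)
                   refl (ν 0) (ν (suc n)) (v ^ suc (suc n)) (u ^ suc (suc n))
    middle : ∀ a b → X′ a b + Y′ a b ≡ Δ ν a * (u ^ suc a * v ^ suc b)
    middle a b = sym (*-distribʳ-+ (u ^ suc a * v ^ suc b) (ν a) (ν (suc a)))

triangleLevel : ℕ → ℕ → ℕ → ℚ
triangleLevel a b zero    = 0ℚ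
triangleLevel a b (suc c) = antidiag c (λ e d → recip e ^ a * recip d ^ b)

triangle : ℕ → ℕ → ℕ → ℚ
triangle M a b = sumℚ M (triangleLevel a b)

module _ (N : ℕ) (ν : ℕ → ℚ) where

  private
    coeff : ℕ → ℕ → ℚ
    coeff i f = Δ^ i ν 0 + Δ^ i ν f

    shuffle-level : ∀ c →
      antidiag N (λ a b → ν a * triangleLevel (suc a) (suc b) c)
        ≡ antidiag N (λ i f → coeff i f * sumℚ c (λ d → recip c ^ suc i * recip d ^ suc f))
    shuffle-level zero    = trans (antidiag-zero N (λ a _ → *-zeroʳ (ν a)))
                                  (sym (antidiag-zero N (λ i f → *-zeroʳ (coeff i f))))
    shuffle-level (suc c) = begin
      antidiag N (λ a b → ν a * antidiag c (λ e d → recip e ^ suc a * recip d ^ suc b))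
        ≡⟨ antidiag-cong N (λ a b _ → sym (antidiag-*ˡ c (ν a) _)) ⟩
      antidiag N (λ a b → antidiag c (λ e d → ν a * (recip e ^ suc a * recip d ^ suc b)))
        ≡⟨ antidiag-antidiag N c _ ⟩
      antidiag c (λ e d → antidiag N (λ a b → ν a * (recip e ^ suc a * recip d ^ suc b)))
        ≡⟨ antidiag-cong c (λ e d e+d≡c →
             geometric-shuffle (recip e) (recip d) s (partialFraction e d e+d≡c) N ν) ⟩
      antidiag c (λ e d → antidiag N (λ i f → s ^ suc i * (coeff₀ i * recip d ^ suc f + Δ^ i ν f * recip e ^ suc f)))
        ≡⟨ antidiag-antidiag N c _ ⟨
      antidiag N (λ i f → antidiag c (λ e d → s ^ suc i * (coeff₀ i * recip d ^ suc f + Δ^ i ν f * recip e ^ suc f)))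
        ≡⟨ antidiag-cong N (λ i f _ → collect i f) ⟩
      antidiag N (λ i f → coeff i f * row i f) ∎
      where
      open ≡-Reasoning
      s : ℚ
      s = recip (suc c)
      coeff₀ : ℕ → ℚ
      coeff₀ i = Δ^ i ν 0
      row : ℕ → ℕ → ℚ
      row i f = sumℚ (suc c) (λ d → s ^ suc i * recip d ^ suc f)
      partialFraction : ∀ e d → e ℕ.+ d ≡ c → s * (recip e + recip d) ≡ recip e * recip d
      partialFraction e d refl = recip-partialFraction e d
      row-as-antidiag : ∀ i f → row i f ≡ antidiag c (λ e d → s ^ suc i * recip e ^ suc f)
      row-as-antidiag i f = sym (antidiag≡sum c (λ e d → s ^ suc i * recip e ^ suc f))
      collect : ∀ i f → antidiag c (λ e d → s ^ suc i * (coeff₀ i * recip d ^ suc f + Δ^ i ν f * recip e ^ suc f))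
                          ≡ coeff i f * row i f
      collect i f = begin
        antidiag c (λ e d → S * (A * recip d ^ suc f + B * recip e ^ suc f))
          ≡⟨ antidiag-cong c (λ e d _ → distrib S A B (recip d ^ suc f) (recip e ^ suc f)) ⟩
        antidiag c (λ e d → A * (S * recip d ^ suc f) + B * (S * recip e ^ suc f))
          ≡⟨ antidiag-+ c _ _ ⟩
        antidiag c (λ e d → A * (S * recip d ^ suc f)) + antidiag c (λ e d → B * (S * recip e ^ suc f))
          ≡⟨ cong₂ _+_ (antidiag-*ˡ c A _) (antidiag-*ˡ c B _) ⟩
        A * antidiag c (λ e d → S * recip d ^ suc f) + B * antidiag c (λ e d → S * recip e ^ suc f)
          ≡⟨ cong₂ (λ x y → A * x + B * y)
               (trans (antidiag-swap c _) (sym (row-as-antidiag i f))) (sym (row-as-antidiag i f)) ⟩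
        A * row i f + B * row i f
          ≡⟨ *-distribʳ-+ (row i f) A B ⟨
        coeff i f * row i f ∎
        where
        S A B : ℚ
        S = s ^ suc i
        A = coeff₀ i
        B = Δ^ i ν f
        distrib : ∀ S A B V U → S * (A * V + B * U) ≡ A * (S * V) + B * (S * U)
        distrib = solve 5 (λ S A B V U → S :* (A :* V :+ B :* U) := A :* (S :* V) :+ B :* (S :* U)) refl

  shuffle : ∀ M → antidiag N (λ a b → ν a * triangle M (suc a) (suc b))
                  ≡ antidiag N (λ i f → (Δ^ i ν 0 + Δ^ i ν f) * Z₂ M (suc i) (suc f))
  shuffle M = begin
    antidiag N (λ a b → ν a * triangle M (suc a) (suc b))
      ≡⟨ antidiag-cong N (λ a b _ → sym (sum-*ˡ M (ν a) _)) ⟩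
    antidiag N (λ a b → sumℚ M (λ c → ν a * triangleLevel (suc a) (suc b) c))
      ≡⟨ sum-antidiag M N _ ⟨
    sumℚ M (λ c → antidiag N (λ a b → ν a * triangleLevel (suc a) (suc b) c))
      ≡⟨ sum-cong M (λ c _ → shuffle-level c) ⟩
    sumℚ M (λ c → antidiag N (λ i f → coeff i f * sumℚ c (λ d → recip c ^ suc i * recip d ^ suc f)))
      ≡⟨ sum-antidiag M N _ ⟩
    antidiag N (λ i f → sumℚ M (λ c → coeff i f * sumℚ c (λ d → recip c ^ suc i * recip d ^ suc f)))
      ≡⟨ antidiag-cong N (λ i f _ → sum-*ˡ M (coeff i f) _) ⟩
    antidiag N (λ i f → coeff i f * Z₂ M (suc i) (suc f)) ∎
    where open ≡-Reasoning

-- Double shuffle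

gap : ℕ → ℕ → ℕ → ℚ
gap M a b = Z₁ M a * Z₁ M b - triangle M a b

weightedGap : ℕ → ℕ → (ℕ → ℚ) → ℚ
weightedGap M N ν = antidiag N (λ a b → ν a * gap M (suc a) (suc b))

doubleShuffleCoeff : (ℕ → ℚ) → ℕ → ℕ → ℚ
doubleShuffleCoeff ν i f = ν i + ν f - (Δ^ i ν 0 + Δ^ i ν f)

doubleShuffleCoeff-zero : ∀ ν f → doubleShuffleCoeff ν 0 f ≡ 0ℚ
doubleShuffleCoeff-zero ν f = +-inverseʳ (ν 0 + ν f)

module _ (M N : ℕ) (ν : ℕ → ℚ) where

  private
    Z₂ₛ : ℕ → ℕ → ℚ
    Z₂ₛ i f = Z₂ M (suc i) (suc f)
    Zₙ totalWeight : ℚ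
    Zₙ = Z₁ M (suc (suc N))
    totalWeight = antidiag N (λ a _ → ν a)

  weighted-stuffle :
    antidiag N (λ a b → ν a * (Z₁ M (suc a) * Z₁ M (suc b)))
      ≡ antidiag N (λ a b → ν a * Z₂ₛ a b) + antidiag N (λ a b → ν b * Z₂ₛ a b) + totalWeight * Zₙ
  weighted-stuffle = begin
    antidiag N (λ a b → ν a * (Z₁ M (suc a) * Z₁ M (suc b)))
      ≡⟨ antidiag-cong N (λ a b a+b≡N → pointwise a b a+b≡N) ⟩
    antidiag N (λ a b → (ν a * Z₂ₛ a b + ν a * Z₂ₛ b a) + Zₙ * ν a)
      ≡⟨ antidiag-+ N _ _ ⟩
    antidiag N (λ a b → ν a * Z₂ₛ a b + ν a * Z₂ₛ b a) + antidiag N (λ a b → Zₙ * ν a)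
      ≡⟨ cong₂ _+_ (antidiag-+ N _ _) (antidiag-*ˡ N Zₙ (λ a _ → ν a)) ⟩
    antidiag N (λ a b → ν a * Z₂ₛ a b) + antidiag N (λ a b → ν a * Z₂ₛ b a) + Zₙ * totalWeight
      ≡⟨ cong₂ (λ x y → antidiag N (λ a b → ν a * Z₂ₛ a b) + x + y) (antidiag-swap N _) (*-comm _ totalWeight) ⟩
    antidiag N (λ a b → ν a * Z₂ₛ a b) + antidiag N (λ a b → ν b * Z₂ₛ a b) + totalWeight * Zₙ ∎
    where
    open ≡-Reasoning
    weight-degree : ∀ a b → a ℕ.+ b ≡ N → suc a ℕ.+ suc b ≡ suc (suc N)
    weight-degree a b refl = cong suc (ℕₚ.+-suc a b)
    pointwise : ∀ a b → a ℕ.+ b ≡ N →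
      ν a * (Z₁ M (suc a) * Z₁ M (suc b)) ≡ (ν a * Z₂ₛ a b + ν a * Z₂ₛ b a) + Zₙ * ν a
    pointwise a b a+b≡N = begin
      ν a * (Z₁ M (suc a) * Z₁ M (suc b))
        ≡⟨ cong (ν a *_) (Z₁-stuffle M (suc a) (suc b)) ⟩
      ν a * (Z₂ₛ a b + Z₂ₛ b a + Z₁ M (suc a ℕ.+ suc b))
        ≡⟨ cong (λ k → ν a * (Z₂ₛ a b + Z₂ₛ b a + Z₁ M k)) (weight-degree a b a+b≡N) ⟩
      ν a * (Z₂ₛ a b + Z₂ₛ b a + Zₙ)
        ≡⟨ solve 4 (λ n x y z → n :* (x :+ y :+ z) := (n :* x :+ n :* y) :+ z :* n) refl
             (ν a) (Z₂ₛ a b) (Z₂ₛ b a) Zₙ ⟩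
      (ν a * Z₂ₛ a b + ν a * Z₂ₛ b a) + Zₙ * ν a ∎

  weightedGap-expansion :
    weightedGap M N ν ≡ antidiag N (λ i f → doubleShuffleCoeff ν i f * Z₂ₛ i f) + totalWeight * Zₙ
  weightedGap-expansion = begin
    antidiag N (λ a b → ν a * (Z₁ M (suc a) * Z₁ M (suc b) - triangle M (suc a) (suc b)))
      ≡⟨ antidiag-cong N (λ a b _ → *-distribˡ-- (ν a) _ _) ⟩
    antidiag N (λ a b → ν a * (Z₁ M (suc a) * Z₁ M (suc b)) - ν a * triangle M (suc a) (suc b))
      ≡⟨ antidiag-- N _ _ ⟩
    antidiag N (λ a b → ν a * (Z₁ M (suc a) * Z₁ M (suc b))) - antidiag N (λ a b → ν a * triangle M (suc a) (suc b))
      ≡⟨ cong₂ _-_ weighted-stuffle (shuffle N ν M) ⟩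
    (P + Q + totalWeight * Zₙ) - S
      ≡⟨ solve 4 (λ p q z s → p :+ q :+ z :- s := (p :+ q :- s) :+ z) refl P Q (totalWeight * Zₙ) S ⟩
    (P + Q - S) + totalWeight * Zₙ
      ≡⟨ cong (_+ totalWeight * Zₙ) combine ⟩
    antidiag N (λ i f → doubleShuffleCoeff ν i f * Z₂ₛ i f) + totalWeight * Zₙ ∎
    where
    open ≡-Reasoning
    P Q S : ℚ
    P = antidiag N (λ a b → ν a * Z₂ₛ a b)
    Q = antidiag N (λ a b → ν b * Z₂ₛ a b)
    S = antidiag N (λ i f → (Δ^ i ν 0 + Δ^ i ν f) * Z₂ₛ i f)
    *-distribˡ-- : ∀ x y z → x * (y - z) ≡ x * y - x * z
    *-distribˡ-- = solve 3 (λ x y z → x :* (y :- z) := x :* y :- x :* z) refl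
    factor : ∀ x y p q z → x * z + y * z - (p + q) * z ≡ (x + y - (p + q)) * z
    factor = solve 5 (λ x y p q z → x :* z :+ y :* z :- (p :+ q) :* z := (x :+ y :- (p :+ q)) :* z) refl
    combine : P + Q - S ≡ antidiag N (λ i f → doubleShuffleCoeff ν i f * Z₂ₛ i f)
    combine = begin
      P + Q - S                                                           ≡⟨ cong (_- S) (antidiag-+ N _ _) ⟨
      antidiag N (λ a b → ν a * Z₂ₛ a b + ν b * Z₂ₛ a b) - S              ≡⟨ antidiag-- N _ _ ⟨
      antidiag N (λ a b → ν a * Z₂ₛ a b + ν b * Z₂ₛ a b - (Δ^ a ν 0 + Δ^ a ν b) * Z₂ₛ a b)
        ≡⟨ antidiag-cong N (λ i f _ → factor (ν i) (ν f) (Δ^ i ν 0) (Δ^ i ν f) (Z₂ₛ i f)) ⟩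
      antidiag N (λ i f → doubleShuffleCoeff ν i f * Z₂ₛ i f) ∎

-- The gap between square and triangular truncation

≮⇒<ᵇ-false : ∀ {m n} → ¬ m < n → (m ℕ.<ᵇ n) ≡ false
≮⇒<ᵇ-false {m} {n} m≮n with m ℕ.<ᵇ n in eq
... | true  = ⊥-elim (m≮n (ℕₚ.<ᵇ⇒< m n (subst T (sym eq) _)))
... | false = refl

if-<ᵇ-split : ∀ k M x → (if k ℕ.<ᵇ M then x else 0ℚ)
                        ≡ (if suc k ℕ.<ᵇ M then x else 0ℚ) + (if suc k ℕ.≡ᵇ M then x else 0ℚ)
if-<ᵇ-split k       zero                x = refl
if-<ᵇ-split zero    (suc zero)          x = sym (+-identityˡ x)
if-<ᵇ-split zero    (suc (suc M))       x = sym (+-identityʳ x)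
if-<ᵇ-split (suc k) (suc M)             x = if-<ᵇ-split k M x

+-≡ᵇ-shift : ∀ i j c → i ≤ c → (i ℕ.+ j ℕ.≡ᵇ c) ≡ (j ℕ.≡ᵇ c ∸ i)
+-≡ᵇ-shift zero    j c       _         = refl
+-≡ᵇ-shift (suc i) j (suc c) (s≤s i≤c) = +-≡ᵇ-shift i j c i≤c

module _ (a b : ℕ) where

  private
    g : ℕ → ℕ → ℚ
    g i j = recip i ^ a * recip j ^ b

  insideTriangle outsideTriangle onDiagonal : ℕ → ℕ → ℕ → ℚ
  insideTriangle  M i j = if suc (i ℕ.+ j) ℕ.<ᵇ M then g i j else 0ℚ
  outsideTriangle M i j = if suc (i ℕ.+ j) ℕ.<ᵇ M then 0ℚ else g i j
  onDiagonal      M i j = if suc (i ℕ.+ j) ℕ.≡ᵇ M then g i j else 0ℚ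

  private
    box-insideTriangle-suc : ∀ M → box (suc M) (insideTriangle (suc M)) ≡ box M (insideTriangle (suc M))
    box-insideTriangle-suc M = begin
      sumℚ M (λ i → sumℚ M (inside i) + inside i M) + sumℚ (suc M) (inside M)
        ≡⟨ cong₂ _+_ (sum-cong M (λ i _ → trans (+-congˡ (sumℚ M (inside i)) (lastColumn i)) (+-identityʳ _)))
                     (trans (sum-cong (suc M) (λ j _ → lastRow j)) (sum-zero (suc M))) ⟩
      box M (insideTriangle (suc M)) + 0ℚ
        ≡⟨ +-identityʳ _ ⟩
      box M (insideTriangle (suc M)) ∎
      where
      open ≡-Reasoning
      inside : ℕ → ℕ → ℚ
      inside = insideTriangle (suc M)
      lastColumn : ∀ i → insideTriangle (suc M) i M ≡ 0ℚ
      lastColumn i = cong (λ t → if t then g i M else 0ℚ) (≮⇒<ᵇ-false (ℕₚ.≤⇒≯ (ℕₚ.m≤n+m M i)))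
      lastRow : ∀ j → insideTriangle (suc M) M j ≡ 0ℚ
      lastRow j = cong (λ t → if t then g M j else 0ℚ) (≮⇒<ᵇ-false (ℕₚ.≤⇒≯ (ℕₚ.m≤m+n M j)))

    box-onDiagonal : ∀ M → box M (onDiagonal M) ≡ triangleLevel a b M
    box-onDiagonal zero    = refl
    box-onDiagonal (suc c) = begin
      sumℚ (suc c) (λ i → sumℚ (suc c) (λ j → if i ℕ.+ j ℕ.≡ᵇ c then g i j else 0ℚ))
        ≡⟨ sum-cong (suc c) (λ i i<1+c → trans
             (sum-cong (suc c) (λ j _ → cong (λ t → if t then g i j else 0ℚ)
                                              (+-≡ᵇ-shift i j c (ℕₚ.≤-pred i<1+c))))
             (sum-indicator (suc c) (c ∸ i) (g i) (s≤s (ℕₚ.m∸n≤m c i)))) ⟩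
      sumℚ (suc c) (λ i → g i (c ∸ i))
        ≡⟨ antidiag≡sum c g ⟨
      antidiag c g ∎
      where open ≡-Reasoning

  triangle≡box : ∀ M → triangle M a b ≡ box M (insideTriangle M)
  triangle≡box zero    = refl
  triangle≡box (suc M) = begin
    triangle M a b + triangleLevel a b M
      ≡⟨ cong₂ _+_ (triangle≡box M) (sym (box-onDiagonal M)) ⟩
    box M (insideTriangle M) + box M (onDiagonal M)
      ≡⟨ box-+ M (insideTriangle M) (onDiagonal M) ⟨
    box M (λ i j → insideTriangle M i j + onDiagonal M i j)
      ≡⟨ sum-cong M (λ i _ → sum-cong M (λ j _ → sym (if-<ᵇ-split (i ℕ.+ j) M (g i j)))) ⟩
    box M (insideTriangle (suc M))
      ≡⟨ box-insideTriangle-suc M ⟨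
    box (suc M) (insideTriangle (suc M)) ∎
    where open ≡-Reasoning

  gap≡box : ∀ M → gap M a b ≡ box M (outsideTriangle M)
  gap≡box M = begin
    Z₁ M a * Z₁ M b - triangle M a b
      ≡⟨ cong₂ _-_ (Z₁*Z₁≡box M a b) (triangle≡box M) ⟩
    box M g - box M (insideTriangle M)
      ≡⟨ box-- M g (insideTriangle M) ⟨
    box M (λ i j → g i j - insideTriangle M i j)
      ≡⟨ sum-cong M (λ i _ → sum-cong M (λ j _ → complement (suc (i ℕ.+ j) ℕ.<ᵇ M) (g i j))) ⟩
    box M (outsideTriangle M) ∎
    where
    open ≡-Reasoning
    complement : ∀ t x → x - (if t then x else 0ℚ) ≡ (if t then 0ℚ else x)
    complement true  x = +-inverseʳ x
    complement false x = trans (+-congˡ x (sym (neg-distrib-+ 0ℚ 0ℚ))) (+-identityʳ x)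

gap-nonNeg : ∀ M a b → 0ℚ ℚ.≤ gap M a b
gap-nonNeg M a b = subst (0ℚ ℚ.≤_) (sym (gap≡box a b M)) (box-nonNeg M pointwise)
  where
  pointwise : ∀ i j → 0ℚ ℚ.≤ outsideTriangle a b M i j
  pointwise i j with suc (i ℕ.+ j) ℕ.<ᵇ M
  ... | true  = ≤-refl
  ... | false = *-nonNeg (recip^-nonNeg i a) (recip^-nonNeg j b)

gap-antimono : ∀ M a a′ b b′ → gap M (a ℕ.+ a′) (b ℕ.+ b′) ℚ.≤ gap M a b
gap-antimono M a a′ b b′ =
  subst₂ ℚ._≤_ (sym (gap≡box (a ℕ.+ a′) (b ℕ.+ b′) M)) (sym (gap≡box a b M)) (box-mono-≤ M pointwise)
  where
  pointwise : ∀ i j → outsideTriangle (a ℕ.+ a′) (b ℕ.+ b′) M i j ℚ.≤ outsideTriangle a b M i j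
  pointwise i j with suc (i ℕ.+ j) ℕ.<ᵇ M
  ... | true  = ≤-refl
  ... | false = *-mono-≤-nonNeg (recip^-nonNeg i (a ℕ.+ a′)) (recip^-nonNeg j (b ℕ.+ b′))
                                (^-antimono-+ a a′ (recip-nonNeg i) (recip≤1 i))
                                (^-antimono-+ b b′ (recip-nonNeg j) (recip≤1 j))

count-outsideTriangle : ∀ M i → sumℚ M (outsideTriangle 0 0 M i) ℚ.≤ ℕ→ℚ (suc i)
count-outsideTriangle M i = begin
  sumℚ M (outsideTriangle 0 0 M i)
    ≡⟨ sum-cong M (λ j _ → cong (λ b → if b then 0ℚ else 1ℚ) (shift i j M)) ⟩
  sumℚ M (λ j → if j ℕ.<ᵇ M ∸ suc i then 0ℚ else 1ℚ)
    ≡⟨ count M (M ∸ suc i) ⟩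
  ℕ→ℚ (M ∸ (M ∸ suc i))
    ≤⟨ ℕ→ℚ-mono-≤ (m∸[m∸n]≤n M (suc i)) ⟩
  ℕ→ℚ (suc i) ∎
  where
  open ≤-Reasoning
  m∸[m∸n]≤n : ∀ m n → m ∸ (m ∸ n) ≤ n
  m∸[m∸n]≤n m n with ℕₚ.≤-total n m
  ... | inj₁ n≤m = ℕₚ.≤-reflexive (ℕₚ.m∸[m∸n]≡n n≤m)
  ... | inj₂ m≤n = subst (_≤ n) (cong (m ∸_) (sym (ℕₚ.m≤n⇒m∸n≡0 m≤n))) m≤n
  shift : ∀ i j M → (suc (i ℕ.+ j) ℕ.<ᵇ M) ≡ (j ℕ.<ᵇ M ∸ suc i)
  shift zero    j zero    = refl
  shift zero    j (suc M) = refl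
  shift (suc i) j zero    = refl
  shift (suc i) j (suc M) = shift i j M
  count : ∀ K t → sumℚ K (λ j → if j ℕ.<ᵇ t then 0ℚ else 1ℚ) ≡ ℕ→ℚ (K ∸ t)
  count zero    t = cong ℕ→ℚ (sym (ℕₚ.0∸n≡0 t))
  count (suc K) t with K ℕ.<ᵇ t in eq
  ... | true  = trans (+-identityʳ _) (trans (count K t)
                  (cong ℕ→ℚ (trans (ℕₚ.m≤n⇒m∸n≡0 (ℕₚ.<⇒≤ K<t)) (sym (ℕₚ.m≤n⇒m∸n≡0 K<t)))))
    where
    K<t : K < t
    K<t = ℕₚ.<ᵇ⇒< K t (subst T (sym eq) _)
  ... | false = trans (cong (_+ 1ℚ) (count K t))
                  (trans (sym (ℕ→ℚ-suc (K ∸ t))) (cong ℕ→ℚ (sym (ℕₚ.+-∸-assoc 1 t≤K))))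
    where
    t≤K : t ≤ K
    t≤K = ℕₚ.≮⇒≥ (λ K<t → subst T eq (ℕₚ.<⇒<ᵇ K<t))

-- A pair outside the triangle has i + j + 1 ≥ M, so its larger index has reciprocal at most 2/(M+1).
large-index : ∀ {M} i j → M ≤ suc (i ℕ.+ j) → M ≤ suc (i ℕ.+ i) ⊎ M ≤ suc (j ℕ.+ j)
large-index i j M≤1+i+j with ℕₚ.≤-total i j
... | inj₁ i≤j = inj₂ (ℕₚ.≤-trans M≤1+i+j (s≤s (ℕₚ.+-monoˡ-≤ j i≤j)))
... | inj₂ j≤i = inj₁ (ℕₚ.≤-trans M≤1+i+j (s≤s (ℕₚ.+-monoʳ-≤ i j≤i)))

module _ (M : ℕ) where

  private
    r t S : ℚ
    r = recip M
    t = r + r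
    S = sumℚ M (λ j → recip j ^ 2)

    0≤r : 0ℚ ℚ.≤ r
    0≤r = recip-nonNeg M

    0≤t : 0ℚ ℚ.≤ t
    0≤t = +-nonNeg 0≤r 0≤r

    0≤rM : 0ℚ ℚ.≤ r * ℕ→ℚ M
    0≤rM = *-nonNeg 0≤r (ℕ→ℚ-nonNeg M)

    0≤8r : 0ℚ ℚ.≤ r * ℕ→ℚ 8
    0≤8r = *-nonNeg 0≤r (ℕ→ℚ-nonNeg 8)

    outside⇒large : ∀ i j → (suc (i ℕ.+ j) ℕ.<ᵇ M) ≡ false → M ≤ suc (i ℕ.+ i) ⊎ M ≤ suc (j ℕ.+ j)
    outside⇒large i j eq = large-index i j (ℕₚ.≮⇒≥ (λ lt → subst T eq (ℕₚ.<⇒<ᵇ lt)))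

    outsideTriangle-2-2-≤ : ∀ i j → outsideTriangle 2 2 M i j ℚ.≤ t ^ 2 * (recip i ^ 2 + recip j ^ 2)
    outsideTriangle-2-2-≤ i j with suc (i ℕ.+ j) ℕ.<ᵇ M in eq
    ... | true  = *-nonNeg (^-nonNeg 2 0≤t) (+-nonNeg (recip^-nonNeg i 2) (recip^-nonNeg j 2))
    ... | false with outside⇒large i j eq
    ...   | inj₁ large-i = begin
      recip i ^ 2 * recip j ^ 2            ≤⟨ *-monoʳ-≤-nonNeg (recip j ^ 2) {{ℚ.nonNegative (recip^-nonNeg j 2)}}
                                                (^-mono-≤ 2 (recip-nonNeg i) (recip-≤-double i M large-i)) ⟩
      t ^ 2 * recip j ^ 2                  ≤⟨ *-monoˡ-≤-nonNeg (t ^ 2) {{ℚ.nonNegative (^-nonNeg 2 0≤t)}}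
                                                (y≤x+y _ (recip^-nonNeg i 2)) ⟩
      t ^ 2 * (recip i ^ 2 + recip j ^ 2)  ∎
      where open ≤-Reasoning
    ...   | inj₂ large-j = begin
      recip i ^ 2 * recip j ^ 2            ≤⟨ *-monoˡ-≤-nonNeg (recip i ^ 2) {{ℚ.nonNegative (recip^-nonNeg i 2)}}
                                                (^-mono-≤ 2 (recip-nonNeg j) (recip-≤-double j M large-j)) ⟩
      recip i ^ 2 * t ^ 2                  ≡⟨ *-comm (recip i ^ 2) (t ^ 2) ⟩
      t ^ 2 * recip i ^ 2                  ≤⟨ *-monoˡ-≤-nonNeg (t ^ 2) {{ℚ.nonNegative (^-nonNeg 2 0≤t)}}
                                                (x≤x+y _ (recip^-nonNeg j 2)) ⟩
      t ^ 2 * (recip i ^ 2 + recip j ^ 2)  ∎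
      where open ≤-Reasoning

    box-t²[recip²+recip²] :
      box M (λ i j → t ^ 2 * (recip i ^ 2 + recip j ^ 2)) ≡ ℕ→ℚ M * (t ^ 2 * S) + ℕ→ℚ M * (t ^ 2 * S)
    box-t²[recip²+recip²] = begin
      sumℚ M (λ i → sumℚ M (λ j → t ^ 2 * (recip i ^ 2 + recip j ^ 2)))
        ≡⟨ sum-cong M (λ i _ → trans (sum-cong M (λ j _ → *-distribˡ-+ (t ^ 2) _ _)) (sum-+ M _ _)) ⟩
      sumℚ M (λ i → sumℚ M (λ _ → t ^ 2 * recip i ^ 2) + sumℚ M (λ j → t ^ 2 * recip j ^ 2))
        ≡⟨ sum-cong M (λ i _ → cong₂ _+_ (sum-const M _) (sum-*ˡ M (t ^ 2) _)) ⟩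
      sumℚ M (λ i → ℕ→ℚ M * (t ^ 2 * recip i ^ 2) + t ^ 2 * S)
        ≡⟨ sum-+ M _ _ ⟩
      sumℚ M (λ i → ℕ→ℚ M * (t ^ 2 * recip i ^ 2)) + sumℚ M (λ _ → t ^ 2 * S)
        ≡⟨ cong₂ _+_ (trans (sum-*ˡ M (ℕ→ℚ M) _) (cong (ℕ→ℚ M *_) (sum-*ˡ M (t ^ 2) _))) (sum-const M _) ⟩
      ℕ→ℚ M * (t ^ 2 * S) + ℕ→ℚ M * (t ^ 2 * S) ∎
      where open ≡-Reasoning

  gap-2-2-bound : gap M 2 2 ℚ.≤ ℕ→ℚ 16 * r
  gap-2-2-bound = begin
    gap M 2 2
      ≡⟨ gap≡box 2 2 M ⟩
    box M (outsideTriangle 2 2 M)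
      ≤⟨ box-mono-≤ M outsideTriangle-2-2-≤ ⟩
    box M (λ i j → t ^ 2 * (recip i ^ 2 + recip j ^ 2))
      ≡⟨ box-t²[recip²+recip²] ⟩
    ℕ→ℚ M * (t ^ 2 * S) + ℕ→ℚ M * (t ^ 2 * S)
      ≡⟨ solve 3 (λ m r s → m :* ((r :+ r) :* ((r :+ r) :* con 1ℚ) :* s) :+ m :* ((r :+ r) :* ((r :+ r) :* con 1ℚ) :* s)
                              := (r :* m) :* (s :* (r :* con (ℕ→ℚ 8)))) refl (ℕ→ℚ M) r S ⟩
    (r * ℕ→ℚ M) * (S * (r * ℕ→ℚ 8))
      ≤⟨ *-mono-≤-nonNeg 0≤rM (*-nonNeg (sum-nonNeg M (λ j _ → recip^-nonNeg j 2)) 0≤8r) (recip*ℕ→ℚ≤1 M)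
                         (*-monoʳ-≤-nonNeg (r * ℕ→ℚ 8) {{ℚ.nonNegative 0≤8r}} (sum-recip²≤2 M)) ⟩
    1ℚ * ((1ℚ + 1ℚ) * (r * ℕ→ℚ 8))
      ≡⟨ solve 1 (λ r → con 1ℚ :* ((con 1ℚ :+ con 1ℚ) :* (r :* con (ℕ→ℚ 8))) := con (ℕ→ℚ 16) :* r) refl r ⟩
    ℕ→ℚ 16 * r ∎
    where open ≤-Reasoning

  private
    0≤t*recip³ : ∀ i → 0ℚ ℚ.≤ t * recip i ^ 3
    0≤t*recip³ i = *-nonNeg 0≤t (recip^-nonNeg i 3)

    outsideTriangle-3-1-≤ : ∀ i j → outsideTriangle 3 1 M i j ℚ.≤ t ^ 3 + (t * recip i ^ 3) * outsideTriangle 0 0 M i j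
    outsideTriangle-3-1-≤ i j with suc (i ℕ.+ j) ℕ.<ᵇ M in eq
    ... | true  = +-nonNeg (^-nonNeg 3 0≤t) (*-nonNeg (0≤t*recip³ i) ≤-refl)
    ... | false with outside⇒large i j eq
    ...   | inj₁ large-i = begin
      recip i ^ 3 * recip j ^ 1       ≤⟨ *-mono-≤-nonNeg (recip^-nonNeg i 3) (recip^-nonNeg j 1)
                                           (^-mono-≤ 3 (recip-nonNeg i) (recip-≤-double i M large-i))
                                           (^≤1 1 (recip-nonNeg j) (recip≤1 j)) ⟩
      t ^ 3 * 1ℚ                      ≡⟨ *-identityʳ (t ^ 3) ⟩
      t ^ 3                           ≤⟨ x≤x+y (t ^ 3) (*-nonNeg (0≤t*recip³ i) 0≤1) ⟩
      t ^ 3 + (t * recip i ^ 3) * 1ℚ  ∎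
      where open ≤-Reasoning
    ...   | inj₂ large-j = begin
      recip i ^ 3 * recip j ^ 1       ≤⟨ *-monoˡ-≤-nonNeg (recip i ^ 3) {{ℚ.nonNegative (recip^-nonNeg i 3)}}
                                           (^-mono-≤ 1 (recip-nonNeg j) (recip-≤-double j M large-j)) ⟩
      recip i ^ 3 * (t * 1ℚ)          ≡⟨ solve 2 (λ x t → x :* (t :* con 1ℚ) := (t :* x) :* con 1ℚ)
                                                  refl (recip i ^ 3) t ⟩
      (t * recip i ^ 3) * 1ℚ          ≤⟨ y≤x+y _ (^-nonNeg 3 0≤t) ⟩
      t ^ 3 + (t * recip i ^ 3) * 1ℚ  ∎
      where open ≤-Reasoning

    recip³*count : ∀ i → recip i ^ 3 * ℕ→ℚ (suc i) ≡ recip i ^ 2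
    recip³*count i = begin
      (recip i * recip i ^ 2) * ℕ→ℚ (suc i)  ≡⟨ solve 3 (λ u x n → (u :* x) :* n := x :* (u :* n)) refl
                                                         (recip i) (recip i ^ 2) (ℕ→ℚ (suc i)) ⟩
      recip i ^ 2 * (recip i * ℕ→ℚ (suc i))  ≡⟨ cong (recip i ^ 2 *_) (recip*ℕ→ℚ-suc i) ⟩
      recip i ^ 2 * 1ℚ                       ≡⟨ *-identityʳ (recip i ^ 2) ⟩
      recip i ^ 2                            ∎
      where open ≡-Reasoning

    -- Only i + 1 indices j with j < M lie outside the triangle, which absorbs one factor 1/(i+1).
    near-diagonal-bound : box M (λ i j → (t * recip i ^ 3) * outsideTriangle 0 0 M i j) ℚ.≤ t * (1ℚ + 1ℚ)
    near-diagonal-bound = begin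
      sumℚ M (λ i → sumℚ M (λ j → (t * recip i ^ 3) * outsideTriangle 0 0 M i j))
        ≡⟨ sum-cong M (λ i _ → sum-*ˡ M (t * recip i ^ 3) _) ⟩
      sumℚ M (λ i → (t * recip i ^ 3) * sumℚ M (outsideTriangle 0 0 M i))
        ≤⟨ sum-mono-≤ M (λ i _ → *-monoˡ-≤-nonNeg (t * recip i ^ 3) {{ℚ.nonNegative (0≤t*recip³ i)}}
                                                   (count-outsideTriangle M i)) ⟩
      sumℚ M (λ i → (t * recip i ^ 3) * ℕ→ℚ (suc i))
        ≡⟨ sum-cong M (λ i _ → trans (*-assoc t _ _) (cong (t *_) (recip³*count i))) ⟩
      sumℚ M (λ i → t * recip i ^ 2)
        ≡⟨ sum-*ˡ M t _ ⟩
      t * S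
        ≤⟨ *-monoˡ-≤-nonNeg t {{ℚ.nonNegative 0≤t}} (sum-recip²≤2 M) ⟩
      t * (1ℚ + 1ℚ) ∎
      where open ≤-Reasoning

  gap-3-1-bound : gap M 3 1 ℚ.≤ ℕ→ℚ 12 * r
  gap-3-1-bound = begin
    gap M 3 1
      ≡⟨ gap≡box 3 1 M ⟩
    box M (outsideTriangle 3 1 M)
      ≤⟨ box-mono-≤ M outsideTriangle-3-1-≤ ⟩
    box M (λ i j → t ^ 3 + (t * recip i ^ 3) * outsideTriangle 0 0 M i j)
      ≡⟨ box-+ M (λ _ _ → t ^ 3) (λ i j → (t * recip i ^ 3) * outsideTriangle 0 0 M i j) ⟩
    box M (λ _ _ → t ^ 3) + box M (λ i j → (t * recip i ^ 3) * outsideTriangle 0 0 M i j)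
      ≤⟨ +-mono-≤ (≤-reflexive (trans (sum-cong M (λ _ _ → sum-const M (t ^ 3))) (sum-const M _))) near-diagonal-bound ⟩
    ℕ→ℚ M * (ℕ→ℚ M * t ^ 3) + t * (1ℚ + 1ℚ)
      ≡⟨ solve 2 (λ m r → m :* (m :* ((r :+ r) :* ((r :+ r) :* ((r :+ r) :* con 1ℚ)))) :+ (r :+ r) :* (con 1ℚ :+ con 1ℚ)
                            := (r :* m) :* ((r :* m) :* (r :* con (ℕ→ℚ 8))) :+ r :* con (ℕ→ℚ 4)) refl (ℕ→ℚ M) r ⟩
    (r * ℕ→ℚ M) * ((r * ℕ→ℚ M) * (r * ℕ→ℚ 8)) + r * ℕ→ℚ 4
      ≤⟨ +-monoˡ-≤ (r * ℕ→ℚ 4) (*-mono-≤-nonNeg 0≤rM (*-nonNeg 0≤rM 0≤8r) (recip*ℕ→ℚ≤1 M)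
                                                  (*-mono-≤-nonNeg 0≤rM 0≤8r (recip*ℕ→ℚ≤1 M) ≤-refl)) ⟩
    1ℚ * (1ℚ * (r * ℕ→ℚ 8)) + r * ℕ→ℚ 4
      ≡⟨ solve 1 (λ r → con 1ℚ :* (con 1ℚ :* (r :* con (ℕ→ℚ 8))) :+ r :* con (ℕ→ℚ 4) := con (ℕ→ℚ 12) :* r)
                 refl r ⟩
    ℕ→ℚ 12 * r ∎
    where open ≤-Reasoning

gap-sym : ∀ M a b → gap M a b ≡ gap M b a
gap-sym M a b = cong₂ _-_ (*-comm (Z₁ M a) (Z₁ M b)) (sum-cong M (λ c _ → level-sym c))
  where
  level-sym : ∀ c → triangleLevel a b c ≡ triangleLevel b a c
  level-sym zero    = refl
  level-sym (suc c) = trans (antidiag-swap c _) (antidiag-cong c (λ e d _ → *-comm (recip d ^ a) (recip e ^ b)))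

Null : (ℕ → ℚ) → Set
Null s = ∀ ε → ℚ.Positive ε → ∃[ K ] (∀ M → K ≤ M → ℚ.∣ s M ∣ ℚ.< ε)

null-cong : ∀ {s s′} → (∀ M → s M ≡ s′ M) → Null s → Null s′
null-cong s≡s′ null-s ε ε>0 with null-s ε ε>0
... | K , bound = K , λ M K≤M → subst (λ x → ℚ.∣ x ∣ ℚ.< ε) (s≡s′ M) (bound M K≤M)

null-zero : Null (λ _ → 0ℚ)
null-zero ε ε>0 = 0 , λ _ _ → positive⁻¹ ε {{ε>0}}

null-+ : ∀ {s s′} → Null s → Null s′ → Null (λ M → s M + s′ M)
null-+ {s} {s′} null-s null-s′ ε ε>0
  with null-s (ε * ½) (pos*pos⇒pos ε {{ε>0}} ½) | null-s′ (ε * ½) (pos*pos⇒pos ε {{ε>0}} ½)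
... | K , bound | K′ , bound′ = K ℕ.⊔ K′ , λ M K⊔K′≤M → begin-strict
  ℚ.∣ s M + s′ M ∣           ≤⟨ ∣p+q∣≤∣p∣+∣q∣ (s M) (s′ M) ⟩
  ℚ.∣ s M ∣ + ℚ.∣ s′ M ∣     <⟨ +-mono-< (bound M (ℕₚ.≤-trans (ℕₚ.m≤m⊔n K K′) K⊔K′≤M))
                                          (bound′ M (ℕₚ.≤-trans (ℕₚ.m≤n⊔m K K′) K⊔K′≤M)) ⟩
  ε * ½ + ε * ½              ≡⟨ solve 1 (λ e → e :* con ½ :+ e :* con ½ := e) refl ε ⟩
  ε                          ∎
  where open ≤-Reasoning

null-*ˡ : ∀ {s} c → Null s → Null (λ M → c * s M)
null-*ˡ {s} c null-s ε ε>0 = K , λ M K≤M → begin-strict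
  ℚ.∣ c * s M ∣          ≡⟨ ∣p*q∣≡∣p∣*∣q∣ c (s M) ⟩
  ℚ.∣ c ∣ * ℚ.∣ s M ∣    ≤⟨ *-monoʳ-≤-nonNeg ℚ.∣ s M ∣ {{∣-∣-nonNeg (s M)}}
                                             (y≤x+y ℚ.∣ c ∣ 0≤1) ⟩
  d * ℚ.∣ s M ∣          <⟨ *-monoʳ-<-pos d (bound M K≤M) ⟩
  d * (ε * 1/ d)         ≡⟨ solve 3 (λ d e i → d :* (e :* i) := e :* (d :* i)) refl d ε (1/ d) ⟩
  ε * (d * 1/ d)         ≡⟨ cong (ε *_) (*-inverseʳ d) ⟩
  ε * 1ℚ                 ≡⟨ *-identityʳ ε ⟩
  ε                      ∎
  where
  open ≤-Reasoning
  d : ℚ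
  d = 1ℚ + ℚ.∣ c ∣
  instance
    d>0 : ℚ.Positive d
    d>0 = pos+nonNeg⇒pos 1ℚ ℚ.∣ c ∣ {{∣-∣-nonNeg c}}
    d≢0 : ℚ.NonZero d
    d≢0 = pos⇒nonZero d
  K : ℕ
  K = proj₁ (null-s (ε * 1/ d) (pos*pos⇒pos ε {{ε>0}} (1/ d) {{1/pos⇒pos d}}))
  bound : ∀ M → K ≤ M → ℚ.∣ s M ∣ ℚ.< ε * 1/ d
  bound = proj₂ (null-s (ε * 1/ d) (pos*pos⇒pos ε {{ε>0}} (1/ d) {{1/pos⇒pos d}}))

-- For ε = p/q, C/(M+1) < 1/q ≤ ε as soon as M ≥ C q.
null-O[recip] : ∀ {s} C → (∀ M → ℚ.∣ s M ∣ ℚ.≤ ℕ→ℚ C * recip M) → Null s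
null-O[recip] {s} C bound (mkℚ (+ suc p) q _) _ = C ℕ.* suc q , λ M Cq≤M → begin-strict
  ℚ.∣ s M ∣                 ≤⟨ bound M ⟩
  ℕ→ℚ C * recip M           ≡⟨ ℕ→ℚ*recip≡ C M ⟩
  fromℚᵘ (ℚᵘ.mkℚᵘ (+ C) M)  <⟨ toℚᵘ-cancel-< (ℚᵘₚ.<-respˡ-≃ (ℚᵘₚ.≃-sym (toℚᵘ-fromℚᵘ (ℚᵘ.mkℚᵘ (+ C) M)))
                                                           (ℚᵘ.*<* (cross M Cq≤M))) ⟩
  mkℚ (+ suc p) q _         ∎
  where
  open ≤-Reasoning
  cross : ∀ M → C ℕ.* suc q ≤ M → + C ℤ.* + suc q ℤ.< + suc p ℤ.* + suc M
  cross M Cq≤M = subst₂ ℤ._<_ (ℤₚ.pos-* C (suc q)) (ℤₚ.pos-* (suc p) (suc M))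
    (ℤ.+<+ (ℕₚ.≤-<-trans Cq≤M (ℕₚ.<-≤-trans (ℕₚ.n<1+n M) (ℕₚ.m≤n*m (suc M) (suc p)))))

gap-null-2-2 : ∀ a b → Null (λ M → gap M (2 ℕ.+ a) (2 ℕ.+ b))
gap-null-2-2 a b = null-O[recip] 16 λ M → begin
  ℚ.∣ gap M (2 ℕ.+ a) (2 ℕ.+ b) ∣  ≡⟨ 0≤p⇒∣p∣≡p (gap-nonNeg M _ _) ⟩
  gap M (2 ℕ.+ a) (2 ℕ.+ b)        ≤⟨ gap-antimono M 2 a 2 b ⟩
  gap M 2 2                        ≤⟨ gap-2-2-bound M ⟩
  ℕ→ℚ 16 * recip M                 ∎
  where open ≤-Reasoning

gap-null-3-1 : ∀ a → Null (λ M → gap M (3 ℕ.+ a) 1)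
gap-null-3-1 a = null-O[recip] 12 λ M → begin
  ℚ.∣ gap M (3 ℕ.+ a) 1 ∣  ≡⟨ 0≤p⇒∣p∣≡p (gap-nonNeg M _ _) ⟩
  gap M (3 ℕ.+ a) (1 ℕ.+ 0) ≤⟨ gap-antimono M 3 a 1 0 ⟩
  gap M 3 1                 ≤⟨ gap-3-1-bound M ⟩
  ℕ→ℚ 12 * recip M          ∎
  where open ≤-Reasoning

null-antidiag : ∀ n (F : ℕ → ℕ → ℕ → ℚ) → (∀ a b → Null (F a b)) →
                Null (λ M → antidiag n (λ a b → F a b M))
null-antidiag zero    F null-F = null-F 0 0
null-antidiag (suc n) F null-F =
  null-+ (null-F 0 (suc n)) (null-antidiag n (λ a → F (suc a)) (λ a → null-F (suc a)))

-- Only the two boundary terms of a weighted gap carry an exponent 1; by symmetry of the gap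
-- they combine into a single multiple of gap M (N + 2) 1.
weightedGap-null : ∀ N ν →
  Null (λ M → (ν 0 + ν (suc N)) * gap M (suc (suc N)) 1) → Null (λ M → weightedGap M (suc N) ν)
weightedGap-null zero ν null-end = null-cong (λ M → begin
    (ν 0 + ν 1) * gap M 2 1            ≡⟨ *-distribʳ-+ (gap M 2 1) (ν 0) (ν 1) ⟩
    ν 0 * gap M 2 1 + ν 1 * gap M 2 1  ≡⟨ cong (λ x → ν 0 * x + ν 1 * gap M 2 1) (gap-sym M 2 1) ⟩
    weightedGap M 1 ν                  ∎)
  null-end
  where open ≡-Reasoning
weightedGap-null (suc N) ν null-end = null-cong (λ M → sym (split M))
  (null-+ null-end (null-antidiag N (λ a b M → ν (suc a) * gap M (2 ℕ.+ a) (2 ℕ.+ b))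
                     (λ a b → null-*ˡ (ν (suc a)) (gap-null-2-2 a b))))
  where
  open ≡-Reasoning
  interior : ℕ → ℚ
  interior M = antidiag N (λ a b → ν (suc a) * gap M (2 ℕ.+ a) (2 ℕ.+ b))
  split : ∀ M → weightedGap M (2 ℕ.+ N) ν ≡ (ν 0 + ν (2 ℕ.+ N)) * gap M (3 ℕ.+ N) 1 + interior M
  split M = begin
    ν 0 * gap M 1 (3 ℕ.+ N) + antidiag (suc N) (λ a b → ν (suc a) * gap M (2 ℕ.+ a) (suc b))
      ≡⟨ cong₂ _+_ (cong (ν 0 *_) (gap-sym M 1 (3 ℕ.+ N)))
                   (antidiag-snoc N (λ a b → ν (suc a) * gap M (2 ℕ.+ a) (suc b))) ⟩
    ν 0 * gap M (3 ℕ.+ N) 1 + (interior M + ν (2 ℕ.+ N) * gap M (3 ℕ.+ N) 1)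
      ≡⟨ solve 4 (λ a x b e → a :* e :+ (x :+ b :* e) := (a :+ b) :* e :+ x) refl
           (ν 0) (interior M) (ν (2 ℕ.+ N)) (gap M (3 ℕ.+ N) 1) ⟩
    (ν 0 + ν (2 ℕ.+ N)) * gap M (3 ℕ.+ N) 1 + interior M ∎

condWeight : (ℕ → Bool) → ℕ → ℚ
condWeight c i = if (2 ℕ.≤ᵇ suc i) ∧ c (suc i) then 1ℚ else 0ℚ

condSum≡antidiag : ∀ c N M →
  condSum c (2 ℕ.+ N) M ≡ antidiag N (λ i f → condWeight c i * Z₂ M (suc i) (suc f))
condSum≡antidiag c N M = begin
  sumℚ (2 ℕ.+ N) summand
    ≡⟨ sum-unshift (suc N) summand ⟩
  0ℚ + sumℚ (suc N) (λ i → summand (suc i))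
    ≡⟨ +-identityˡ _ ⟩
  sumℚ (suc N) (λ i → summand (suc i))
    ≡⟨ sum-cong (suc N) (λ i i<1+N → pointwise i (ℕₚ.≤-pred i<1+N)) ⟩
  sumℚ (suc N) (λ i → condWeight c i * Z₂ M (suc i) (suc (N ∸ i)))
    ≡⟨ antidiag≡sum N _ ⟨
  antidiag N (λ i f → condWeight c i * Z₂ M (suc i) (suc f)) ∎
  where
  open ≡-Reasoning
  summand : ℕ → ℚ
  summand l₁ = if (2 ℕ.≤ᵇ l₁) ∧ c l₁ then ζ₂ M l₁ (2 ℕ.+ N ∸ l₁) else 0ℚ
  if-as-product : ∀ b x → (if b then x else 0ℚ) ≡ (if b then 1ℚ else 0ℚ) * x
  if-as-product true  x = sym (*-identityˡ x)
  if-as-product false x = sym (*-zeroˡ x)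
  pointwise : ∀ i → i ≤ N → summand (suc i) ≡ condWeight c i * Z₂ M (suc i) (suc (N ∸ i))
  pointwise i i≤N = begin
    summand (suc i)
      ≡⟨ cong (λ k → if (2 ℕ.≤ᵇ suc i) ∧ c (suc i) then ζ₂ M (suc i) k else 0ℚ) (ℕₚ.+-∸-assoc 1 i≤N) ⟩
    (if (2 ℕ.≤ᵇ suc i) ∧ c (suc i) then ζ₂ M (suc i) (suc (N ∸ i)) else 0ℚ)
      ≡⟨ if-as-product ((2 ℕ.≤ᵇ suc i) ∧ c (suc i)) _ ⟩
    condWeight c i * ζ₂ M (suc i) (suc (N ∸ i))
      ≡⟨ cong (condWeight c i *_) (ζ₂≡Z₂ M (suc i) (suc (N ∸ i))) ⟩
    condWeight c i * Z₂ M (suc i) (suc (N ∸ i)) ∎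

Combination : Set
Combination = List (ℚ × (ℕ → Bool))

combinedWeight : Combination → ℕ → ℚ
combinedWeight []            i = 0ℚ
combinedWeight ((a , c) ∷ L) i = a * condWeight c i + combinedWeight L i

combinedCondSum : Combination → ℕ → ℕ → ℚ
combinedCondSum []            l M = 0ℚ
combinedCondSum ((a , c) ∷ L) l M = a * condSum c l M + combinedCondSum L l M

combinedWeight-zero : ∀ L → combinedWeight L 0 ≡ 0ℚ
combinedWeight-zero []            = refl
combinedWeight-zero ((a , c) ∷ L) = trans (cong₂ _+_ (*-zeroʳ a) (combinedWeight-zero L)) (+-identityˡ 0ℚ)

combinedCondSum≡antidiag : ∀ L N M →
  antidiag N (λ i f → combinedWeight L i * Z₂ M (suc i) (suc f)) ≡ combinedCondSum L (2 ℕ.+ N) M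
combinedCondSum≡antidiag []            N M = antidiag-zero N (λ i f → *-zeroˡ (Z₂ M (suc i) (suc f)))
combinedCondSum≡antidiag ((a , c) ∷ L) N M = begin
  antidiag N (λ i f → (a * condWeight c i + combinedWeight L i) * Z₂ M (suc i) (suc f))
    ≡⟨ antidiag-cong N (λ i f _ → distrib a (condWeight c i) (combinedWeight L i) (Z₂ M (suc i) (suc f))) ⟩
  antidiag N (λ i f → a * (condWeight c i * Z₂ M (suc i) (suc f)) + combinedWeight L i * Z₂ M (suc i) (suc f))
    ≡⟨ antidiag-+ N _ _ ⟩
  antidiag N (λ i f → a * (condWeight c i * Z₂ M (suc i) (suc f)))
    + antidiag N (λ i f → combinedWeight L i * Z₂ M (suc i) (suc f))
    ≡⟨ cong₂ _+_ (trans (antidiag-*ˡ N a _) (cong (a *_) (sym (condSum≡antidiag c N M))))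
                 (combinedCondSum≡antidiag L N M) ⟩
  a * condSum c (2 ℕ.+ N) M + combinedCondSum L (2 ℕ.+ N) M ∎
  where
  open ≡-Reasoning
  distrib : ∀ a w v z → (a * w + v) * z ≡ a * (w * z) + v * z
  distrib = solve 4 (λ a w v z → (a :* w :+ v) :* z := a :* (w :* z) :+ v :* z) refl

periodic⇒%-invariant : ∀ {A : Set} n .{{_ : ℕ.NonZero n}} (g : ℕ → A) →
                       (∀ i → g (n ℕ.+ i) ≡ g i) → ∀ i → g i ≡ g (i % n)
periodic⇒%-invariant n g period i = trans (cong g (m≡m%n+[m/n]*n i n)) (shift (i ℕ./ n) (i % n))
  where
  shift : ∀ q r → g (r ℕ.+ q ℕ.* n) ≡ g r
  shift zero    r = cong g (ℕₚ.+-identityʳ r)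
  shift (suc q) r = trans (cong g (rearrange r q)) (trans (period (r ℕ.+ q ℕ.* n)) (shift q r))
    where
    rearrange : ∀ r q → r ℕ.+ suc q ℕ.* n ≡ n ℕ.+ (r ℕ.+ q ℕ.* n)
    rearrange r q = ℕ-Ring.solve (r ∷ q ∷ n ∷ [])

OnePeriodTable : (ℕ → ℕ → ℚ) → (ℕ → ℚ) → ℕ → Set
OnePeriodTable C T k = ∀ {i} → i < 6 → ∀ {f} → f < 3 → (i ℕ.+ f) % 3 ≡ k → C i f ≡ T i

onePeriodTable? : ∀ C T k → Dec (OnePeriodTable C T k)
onePeriodTable? C T k =
  ℕₚ.allUpTo? (λ i → ℕₚ.allUpTo? (λ f → ((i ℕ.+ f) % 3 ℕₚ.≟ k) →-dec (C i f ≟ T i)) 3) 6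

module _ (C : ℕ → ℕ → ℚ) (T : ℕ → ℚ) (k : ℕ)
         (C-period₁ : ∀ i f → C (6 ℕ.+ i) f ≡ C i f) (C-period₂ : ∀ i f → C i (3 ℕ.+ f) ≡ C i f)
         (T-period : ∀ i → T (6 ℕ.+ i) ≡ T i) where

  periodic-table : OnePeriodTable C T k → ∀ i f → (i ℕ.+ f) % 3 ≡ k → C i f ≡ T i
  periodic-table table i f i+f≡k = begin
    C i f                  ≡⟨ periodic⇒%-invariant 6 (λ i → C i f) (λ i → C-period₁ i f) i ⟩
    C (i % 6) f            ≡⟨ periodic⇒%-invariant 3 (C (i % 6)) (C-period₂ (i % 6)) f ⟩
    C (i % 6) (f % 3)      ≡⟨ table (m%n<n i 6) (m%n<n f 3) (trans residues i+f≡k) ⟩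
    T (i % 6)              ≡⟨ periodic⇒%-invariant 6 T T-period i ⟨
    T i                    ∎
    where
    open ≡-Reasoning
    residues : (i % 6 ℕ.+ f % 3) % 3 ≡ (i ℕ.+ f) % 3
    residues = begin
      (i % 6 ℕ.+ f % 3) % 3          ≡⟨ %-distribˡ-+ (i % 6) (f % 3) 3 ⟩
      (i % 6 % 3 ℕ.+ f % 3 % 3) % 3  ≡⟨ cong₂ (λ a b → (a ℕ.+ b) % 3)
                                                (m∣n⇒o%n%m≡o%m 3 6 i (divides 2 refl)) (m%n%n≡m%n f 3) ⟩
      (i % 3 ℕ.+ f % 3) % 3          ≡⟨ %-distribˡ-+ i f 3 ⟨
      (i ℕ.+ f) % 3                  ∎

cyclic : ℚ × ℚ × ℚ → ℕ → ℚ
cyclic (x , _ , _) 0                   = x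
cyclic (_ , y , _) 1                   = y
cyclic (_ , _ , z) 2                   = z
cyclic t           (suc (suc (suc n))) = cyclic t n

ΔTriple : ℚ × ℚ × ℚ → ℚ × ℚ × ℚ
ΔTriple (x , y , z) = x + y , y + z , z + x

ΔTriple^ : ℕ → ℚ × ℚ × ℚ → ℚ × ℚ × ℚ
ΔTriple^ zero    t = t
ΔTriple^ (suc i) t = ΔTriple^ i (ΔTriple t)

ΔTriple^-+ : ∀ m n t → ΔTriple^ (m ℕ.+ n) t ≡ ΔTriple^ n (ΔTriple^ m t)
ΔTriple^-+ zero    n t = refl
ΔTriple^-+ (suc m) n t = ΔTriple^-+ m n (ΔTriple t)

Δ-cyclic : ∀ t a → Δ (cyclic t) a ≡ cyclic (ΔTriple t) a
Δ-cyclic t 0                   = refl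
Δ-cyclic t 1                   = refl
Δ-cyclic t 2                   = refl
Δ-cyclic t (suc (suc (suc a))) = Δ-cyclic t a

Δ^-cong : ∀ i {f g} → (∀ a → f a ≡ g a) → ∀ a → Δ^ i f a ≡ Δ^ i g a
Δ^-cong zero    f≡g = f≡g
Δ^-cong (suc i) f≡g = Δ^-cong i (λ a → cong₂ _+_ (f≡g a) (f≡g (suc a)))

Δ^-cyclic : ∀ i t a → Δ^ i (cyclic t) a ≡ cyclic (ΔTriple^ i t) a
Δ^-cyclic zero    t a = refl
Δ^-cyclic (suc i) t a = trans (Δ^-cong i (Δ-cyclic t) a) (Δ^-cyclic i (ΔTriple t) a)

Δ^-+-*ˡ : ∀ i f c g a → Δ^ i (λ b → f b + c * g b) a ≡ Δ^ i f a + c * Δ^ i g a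
Δ^-+-*ˡ zero    f c g a = refl
Δ^-+-*ˡ (suc i) f c g a = trans (Δ^-cong i step a) (Δ^-+-*ˡ i (Δ f) c (Δ g) a)
  where
  step : ∀ b → Δ (λ b → f b + c * g b) b ≡ Δ f b + c * Δ g b
  step b = solve 5 (λ f₀ f₁ c g₀ g₁ → (f₀ :+ c :* g₀) :+ (f₁ :+ c :* g₁) := (f₀ :+ f₁) :+ c :* (g₀ :+ g₁))
                   refl (f b) (f (suc b)) c (g b) (g (suc b))

δ₀ : ℕ → ℚ
δ₀ zero    = 1ℚ
δ₀ (suc _) = 0ℚ

Δ^-δ₀ : ∀ i a → Δ^ i δ₀ a ≡ δ₀ a
Δ^-δ₀ zero    a = refl
Δ^-δ₀ (suc i) a = trans (Δ^-cong i Δ-δ₀ a) (Δ^-δ₀ i a)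
  where
  Δ-δ₀ : ∀ a → Δ δ₀ a ≡ δ₀ a
  Δ-δ₀ zero    = refl
  Δ-δ₀ (suc a) = refl

cyclicCoeff : ℚ × ℚ × ℚ → ℕ → ℕ → ℚ
cyclicCoeff t i f = cyclic t (suc i) + cyclic t f - (cyclic (ΔTriple^ (suc i) t) 0 + cyclic (ΔTriple^ (suc i) t) f)

cyclicCoeff-period₆ : ∀ t → ΔTriple^ 6 t ≡ t → ∀ i f → cyclicCoeff t (6 ℕ.+ i) f ≡ cyclicCoeff t i f
cyclicCoeff-period₆ t period i f = cong (λ u → cyclic t (suc i) + cyclic t f - (cyclic u 0 + cyclic u f))
  (trans (ΔTriple^-+ 6 (suc i) t) (cong (ΔTriple^ (suc i)) period))

cyclic-three : ∀ t n → cyclic t n + cyclic t (1 ℕ.+ n) + cyclic t (2 ℕ.+ n) ≡ cyclic t 0 + cyclic t 1 + cyclic t 2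
cyclic-three t 0                   = refl
cyclic-three t 1                   = solve 3 (λ x y z → y :+ z :+ x := x :+ y :+ z) refl (cyclic t 0) (cyclic t 1) (cyclic t 2)
cyclic-three t 2                   = solve 3 (λ x y z → z :+ x :+ y := x :+ y :+ z) refl (cyclic t 0) (cyclic t 1) (cyclic t 2)
cyclic-three t (suc (suc (suc n))) = cyclic-three t n

sum-δ₀ : ∀ n → sumℚ (suc n) δ₀ ≡ 1ℚ
sum-δ₀ zero    = refl
sum-δ₀ (suc n) = trans (+-identityʳ _) (sum-δ₀ n)

module _ (t : ℚ × ℚ × ℚ) (γ : ℚ) where

  perturbedCyclic : ℕ → ℚ
  perturbedCyclic a = cyclic t a + γ * δ₀ a

  doubleShuffleCoeff-perturbedCyclic : ∀ i f → doubleShuffleCoeff perturbedCyclic (suc i) f ≡ cyclicCoeff t i f - γ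
  doubleShuffleCoeff-perturbedCyclic i f = begin
    perturbedCyclic (suc i) + perturbedCyclic f - (Δ^ (suc i) perturbedCyclic 0 + Δ^ (suc i) perturbedCyclic f)
      ≡⟨ cong (λ e → perturbedCyclic (suc i) + perturbedCyclic f - e) (cong₂ _+_ (expand 0) (expand f)) ⟩
    (cyclic t (suc i) + γ * 0ℚ) + (cyclic t f + γ * δ₀ f) - ((c 0 + γ * 1ℚ) + (c f + γ * δ₀ f))
      ≡⟨ solve 6 (λ a b γ d c₀ c₁ → (a :+ γ :* con 0ℚ) :+ (b :+ γ :* d) :- ((c₀ :+ γ :* con 1ℚ) :+ (c₁ :+ γ :* d))
                                  := a :+ b :- (c₀ :+ c₁) :- γ) refl
           (cyclic t (suc i)) (cyclic t f) γ (δ₀ f) (c 0) (c f) ⟩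
    cyclicCoeff t i f - γ ∎
    where
    open ≡-Reasoning
    c : ℕ → ℚ
    c = cyclic (ΔTriple^ (suc i) t)
    expand : ∀ a → Δ^ (suc i) perturbedCyclic a ≡ c a + γ * δ₀ a
    expand a = begin
      Δ^ (suc i) perturbedCyclic a
        ≡⟨ Δ^-+-*ˡ (suc i) (cyclic t) γ δ₀ a ⟩
      Δ^ (suc i) (cyclic t) a + γ * Δ^ (suc i) δ₀ a
        ≡⟨ cong₂ (λ p q → p + γ * q) (Δ^-cyclic (suc i) t a) (Δ^-δ₀ (suc i) a) ⟩
      c a + γ * δ₀ a ∎

  totalWeight-perturbedCyclic : cyclic t 0 + cyclic t 1 + cyclic t 2 ≡ 0ℚ →
    ∀ n → antidiag (suc n) (λ a _ → perturbedCyclic a) ≡ sumℚ (2 ℕ.+ n % 3) (cyclic t) + γ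
  totalWeight-perturbedCyclic zero-sum n = begin
    antidiag (suc n) (λ a _ → perturbedCyclic a)
      ≡⟨ antidiag≡sum (suc n) (λ a _ → perturbedCyclic a) ⟩
    sumℚ (2 ℕ.+ n) perturbedCyclic
      ≡⟨ sum-+ (2 ℕ.+ n) (cyclic t) (λ a → γ * δ₀ a) ⟩
    sumℚ (2 ℕ.+ n) (cyclic t) + sumℚ (2 ℕ.+ n) (λ a → γ * δ₀ a)
      ≡⟨ cong₂ _+_ (periodic⇒%-invariant 3 partial window n)
                   (trans (sum-*ˡ (2 ℕ.+ n) γ δ₀) (trans (cong (γ *_) (sum-δ₀ (suc n))) (*-identityʳ γ))) ⟩
    sumℚ (2 ℕ.+ n % 3) (cyclic t) + γ ∎
    where
    open ≡-Reasoning
    partial : ℕ → ℚ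
    partial n = sumℚ (2 ℕ.+ n) (cyclic t)
    window : ∀ n → partial (3 ℕ.+ n) ≡ partial n
    window n = begin
      partial n + cyclic t (2 ℕ.+ n) + cyclic t (3 ℕ.+ n) + cyclic t (4 ℕ.+ n)
        ≡⟨ solve 4 (λ s a b c → s :+ a :+ b :+ c := s :+ (a :+ b :+ c))
                   refl (partial n) (cyclic t (2 ℕ.+ n)) (cyclic t n) (cyclic t (1 ℕ.+ n)) ⟩
      partial n + (cyclic t (2 ℕ.+ n) + cyclic t (3 ℕ.+ n) + cyclic t (4 ℕ.+ n))
        ≡⟨ +-congˡ (partial n) (trans (cyclic-three t (2 ℕ.+ n)) zero-sum) ⟩
      partial n + 0ℚ
        ≡⟨ +-identityʳ (partial n) ⟩
      partial n ∎

  -- When x + y + z = 0, ΔTriple maps (x , y , z) to (- z , - x , - y), so it has order 6.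
  module _ (L : Combination) (k : ℕ)
           (period : ΔTriple^ 6 t ≡ t)
           (zero-sum : cyclic t 0 + cyclic t 1 + cyclic t 2 ≡ 0ℚ)
           (L-period : ∀ i → combinedWeight L (7 ℕ.+ i) ≡ combinedWeight L (suc i))
           {table✓ : True (onePeriodTable? (λ i f → cyclicCoeff t i f - γ) (λ i → combinedWeight L (suc i)) k)}
           where

    private
      total : ℚ
      total = sumℚ (2 ℕ.+ k) (cyclic t) + γ

    doubleShuffleCoeff≡combinedWeight : ∀ n → n % 3 ≡ k →
      ∀ i f → i ℕ.+ f ≡ suc n → doubleShuffleCoeff perturbedCyclic i f ≡ combinedWeight L i
    doubleShuffleCoeff≡combinedWeight n n≡k zero    f _ =
      trans (doubleShuffleCoeff-zero perturbedCyclic f) (sym (combinedWeight-zero L))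
    doubleShuffleCoeff≡combinedWeight n n≡k (suc i) f i+f≡1+n =
      trans (doubleShuffleCoeff-perturbedCyclic i f)
            (periodic-table (λ i f → cyclicCoeff t i f - γ) (λ i → combinedWeight L (suc i)) k
                            (λ i f → cong (_- γ) (cyclicCoeff-period₆ t period i f)) (λ _ _ → refl) L-period
                            (toWitness table✓) i f (trans (cong (_% 3) (ℕₚ.suc-injective i+f≡1+n)) n≡k))

    weightedGap≡combination : ∀ n → n % 3 ≡ k → ∀ M →
      weightedGap M (suc n) perturbedCyclic ≡ combinedCondSum L (3 ℕ.+ n) M + total * Z₁ M (3 ℕ.+ n)
    weightedGap≡combination n n≡k M = begin
      weightedGap M (suc n) perturbedCyclic
        ≡⟨ weightedGap-expansion M (suc n) perturbedCyclic ⟩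
      antidiag (suc n) (λ i f → doubleShuffleCoeff perturbedCyclic i f * Z₂ M (suc i) (suc f))
        + antidiag (suc n) (λ a _ → perturbedCyclic a) * Z₁ M (3 ℕ.+ n)
        ≡⟨ cong₂ _+_ (antidiag-cong (suc n) coefficients) (cong (_* Z₁ M (3 ℕ.+ n)) totalWeight) ⟩
      antidiag (suc n) (λ i f → combinedWeight L i * Z₂ M (suc i) (suc f)) + total * Z₁ M (3 ℕ.+ n)
        ≡⟨ cong (_+ total * Z₁ M (3 ℕ.+ n)) (combinedCondSum≡antidiag L (suc n) M) ⟩
      combinedCondSum L (3 ℕ.+ n) M + total * Z₁ M (3 ℕ.+ n) ∎
      where
      open ≡-Reasoning
      coefficients : ∀ i f → i ℕ.+ f ≡ suc n →
        doubleShuffleCoeff perturbedCyclic i f * Z₂ M (suc i) (suc f) ≡ combinedWeight L i * Z₂ M (suc i) (suc f)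
      coefficients i f i+f≡1+n = cong (_* Z₂ M (suc i) (suc f)) (doubleShuffleCoeff≡combinedWeight n n≡k i f i+f≡1+n)
      totalWeight : antidiag (suc n) (λ a _ → perturbedCyclic a) ≡ total
      totalWeight = trans (totalWeight-perturbedCyclic zero-sum n) (cong (λ r → sumℚ (2 ℕ.+ r) (cyclic t) + γ) n≡k)

    combination-null : ∀ n → n % 3 ≡ k →
      Null (λ M → (perturbedCyclic 0 + perturbedCyclic (suc k)) * gap M (2 ℕ.+ n) 1) →
      Null (λ M → combinedCondSum L (3 ℕ.+ n) M + total * Z₁ M (3 ℕ.+ n))
    combination-null n n≡k null-end = null-cong (weightedGap≡combination n n≡k)
      (weightedGap-null n perturbedCyclic (null-cong (λ M → cong (λ e → e * gap M (2 ℕ.+ n) 1) endWeight) null-end))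
      where
      endWeight : perturbedCyclic 0 + perturbedCyclic (suc k) ≡ perturbedCyclic 0 + perturbedCyclic (suc n)
      endWeight = +-congˡ (perturbedCyclic 0) (sym (trans
        (periodic⇒%-invariant 3 (λ m → perturbedCyclic (suc m)) (λ _ → refl) n)
        (cong (λ m → perturbedCyclic (suc m)) n≡k)))

third sixth : ℚ
third = + 1 / 3
sixth = + 1 / 6

-- In each case the hypotheses of combination-null on t, γ and L, including the one-period table,
-- hold by evaluation.
module _ (n : ℕ) where

  private
    l : ℕ
    l = 3 ℕ.+ n

    A₃ A₄ A₅ B₀ B₁ : ℕ → ℚ
    A₃ = condSum (≡mod6 3) l
    A₄ = condSum (≡mod6 4) l
    A₅ = condSum (≡mod6 5) l
    B₀ = condSum (≡mod2 0) l
    B₁ = condSum (≡mod2 1) l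

    gapTerm-zero : Null (λ M → 0ℚ * gap M (2 ℕ.+ n) 1)
    gapTerm-zero = null-cong (λ M → sym (*-zeroˡ (gap M (2 ℕ.+ n) 1))) null-zero

  l≡0-mod-3 : n % 3 ≡ 0 → (λ M → A₃ M - A₄ M - A₅ M) ≈lim (λ M → third * B₁ M)
  l≡0-mod-3 n≡0 = null-cong rearrange (combination-null t γ L 0 refl refl (λ _ → refl) n n≡0 gapTerm-zero)
    where
    t : ℚ × ℚ × ℚ
    t = ℚ.- third , 0ℚ , third
    γ : ℚ
    γ = third
    L : Combination
    L = (1ℚ , ≡mod6 3) ∷ (ℚ.- 1ℚ , ≡mod6 4) ∷ (ℚ.- 1ℚ , ≡mod6 5) ∷ (ℚ.- third , ≡mod2 1) ∷ []
    rearrange : ∀ M → combinedCondSum L l M + 0ℚ * Z₁ M l ≡ A₃ M - A₄ M - A₅ M - third * B₁ M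
    rearrange M = solve 5 (λ a b c d z → con 1ℚ :* a :+ (con (ℚ.- 1ℚ) :* b :+ (con (ℚ.- 1ℚ) :* c
                                           :+ (con (ℚ.- third) :* d :+ con 0ℚ))) :+ con 0ℚ :* z
                                         := a :- b :- c :- con third :* d)
                          refl (A₃ M) (A₄ M) (A₅ M) (B₁ M) (Z₁ M l)

  l≡1-mod-3 : n % 3 ≡ 1 → (λ M → A₃ M + A₄ M - A₅ M) ≈lim (λ M → third * B₀ M)
  l≡1-mod-3 n≡1 = null-cong rearrange (combination-null t γ L 1 refl refl (λ _ → refl) n n≡1 (gapTerm n n≡1))
    where
    t : ℚ × ℚ × ℚ
    t = 0ℚ , ℚ.- third , third
    γ : ℚ
    γ = 0ℚ
    L : Combination
    L = (1ℚ , ≡mod6 3) ∷ (1ℚ , ≡mod6 4) ∷ (ℚ.- 1ℚ , ≡mod6 5) ∷ (ℚ.- third , ≡mod2 0) ∷ []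
    gapTerm : ∀ m → m % 3 ≡ 1 → Null (λ M → third * gap M (2 ℕ.+ m) 1)
    gapTerm (suc a) _ = null-*ˡ third (gap-null-3-1 a)
    rearrange : ∀ M → combinedCondSum L l M + 0ℚ * Z₁ M l ≡ A₃ M + A₄ M - A₅ M - third * B₀ M
    rearrange M = solve 5 (λ a b c d z → con 1ℚ :* a :+ (con 1ℚ :* b :+ (con (ℚ.- 1ℚ) :* c
                                           :+ (con (ℚ.- third) :* d :+ con 0ℚ))) :+ con 0ℚ :* z
                                         := a :+ b :- c :- con third :* d)
                          refl (A₃ M) (A₄ M) (A₅ M) (B₀ M) (Z₁ M l)

  l≡2-mod-3 : n % 3 ≡ 2 → (λ M → A₄ M) ≈lim (λ M → sixth * ζ₁ M l - third * B₁ M)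
  l≡2-mod-3 n≡2 = null-cong rearrange (combination-null t γ L 2 refl refl (λ _ → refl) n n≡2 gapTerm-zero)
    where
    t : ℚ × ℚ × ℚ
    t = sixth , 0ℚ , ℚ.- sixth
    γ : ℚ
    γ = ℚ.- third
    L : Combination
    L = (1ℚ , ≡mod6 4) ∷ (third , ≡mod2 1) ∷ []
    rearrange : ∀ M → combinedCondSum L l M + (ℚ.- sixth) * Z₁ M l ≡ A₄ M - (sixth * ζ₁ M l - third * B₁ M)
    rearrange M = begin
      combinedCondSum L l M + (ℚ.- sixth) * Z₁ M l
        ≡⟨ solve 3 (λ a d z → con 1ℚ :* a :+ (con third :* d :+ con 0ℚ) :+ con (ℚ.- sixth) :* z
                               := a :- (con sixth :* z :- con third :* d))
                   refl (A₄ M) (B₁ M) (Z₁ M l) ⟩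
      A₄ M - (sixth * Z₁ M l - third * B₁ M)
        ≡⟨ cong (λ z → A₄ M - (sixth * z - third * B₁ M)) (ζ₁≡Z₁ M l) ⟨
      A₄ M - (sixth * ζ₁ M l - third * B₁ M) ∎
      where open ≡-Reasoning

theorem1 : (l : ℕ) → 3 ≤ l →
    (l % 3 ≡ 0 →
      (λ M → condSum (≡mod6 3) l M - condSum (≡mod6 4) l M - condSum (≡mod6 5) l M)
        ≈lim (λ M → ((+ 1) / 3) * condSum (≡mod2 1) l M))
    × (l % 3 ≡ 1 →
      (λ M → condSum (≡mod6 3) l M + condSum (≡mod6 4) l M - condSum (≡mod6 5) l M)
        ≈lim (λ M → ((+ 1) / 3) * condSum (≡mod2 0) l M))
    × (l % 3 ≡ 2 →
      (λ M → condSum (≡mod6 4) l M)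
        ≈lim (λ M → ((+ 1) / 6) * ζ₁ M l - ((+ 1) / 3) * condSum (≡mod2 1) l M))
theorem1 1                   (s≤s ())
theorem1 2                   (s≤s (s≤s ()))
theorem1 (suc (suc (suc n))) _ = l≡0-mod-3 n , l≡1-mod-3 n , l≡2-mod-3 n
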